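{- Let $\mathbb F_q$ be a finite field with $q\ge3$ elements, $A=\mathbb F_q[T]$, and $P$ a monic irreducible polynomial of $A$. Then $\phi_{P-1}(1)\equiv0\pmod{P^2}$ if and only if there exists $a\in A\setminus PA$ such that $\phi_a(1)\equiv0\pmod{P^2}$.
   Context: $\phi$ is the Carlitz module: $a\mapsto\phi_a$, the $\mathbb F_q$-algebra morphism into $\mathbb F_q$-linear polynomials over $A$ with $\phi_T(X)=TX+X^q$. -}

module Defs where

open import Level using (Level; _⊔_)
open import Algebra.Bundles using (CommutativeRing; RawSemiring)
open import Data.Nat using (ℕ; zero; suc; _<_)
open import Data.Fin using (Fin)
open import Data.List using (List; []; _∷_; map)
open import Data.Product using (∃)
open import Relation.Nullary using (¬_)
open import Relation.Binary.PropositionalEquality using (_≡_)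
import Algebra.Definitions.RawSemiring as RSDefs

record FiniteField (c ℓ : Level) : Set (Level.suc (c ⊔ ℓ)) where
  field
    cring    : CommutativeRing c ℓ
  open CommutativeRing cring public
  field
    0≉1      : ¬ (0# ≈ 1#)
    inverse  : ∀ x → ¬ (x ≈ 0#) → ∃ λ y → x * y ≈ 1#
    size     : ℕ
    enum     : Fin size → Carrier
    enum-inj : ∀ i j → enum i ≈ enum j → i ≡ j
    enum-sur : ∀ x → ∃ λ i → enum i ≈ x

module Poly {c ℓ : Level} (F : FiniteField c ℓ) where
  open FiniteField F renaming (Carrier to K)

  -- polynomials as coefficient lists, lowest degree first
  A : Set c
  A = List K

  coeff : A → ℕ → K
  coeff []      _       = 0#
  coeff (a ∷ p) zero    = a
  coeff (a ∷ p) (suc n) = coeff p n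

  _≈ₚ_ : A → A → Set ℓ
  p ≈ₚ r = ∀ n → coeff p n ≈ coeff r n

  _+ₚ_ : A → A → A
  []      +ₚ r       = r
  (a ∷ p) +ₚ []      = a ∷ p
  (a ∷ p) +ₚ (b ∷ r) = (a + b) ∷ (p +ₚ r)

  -ₚ_ : A → A
  -ₚ p = map -_ p

  _-ₚ_ : A → A → A
  p -ₚ r = p +ₚ (-ₚ r)

  _·ₚ_ : K → A → A
  a ·ₚ p = map (a *_) p

  _*ₚ_ : A → A → A
  []      *ₚ r = []
  (a ∷ p) *ₚ r = (a ·ₚ r) +ₚ (0# ∷ (p *ₚ r))

  0ₚ 1ₚ Tₚ : A
  0ₚ = []
  1ₚ = 1# ∷ []
  Tₚ = 0# ∷ 1# ∷ []

  _^ₚ_ : A → ℕ → A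
  p ^ₚ zero  = 1ₚ
  p ^ₚ suc n = p *ₚ (p ^ₚ n)

  A-rawSemiring : RawSemiring c ℓ
  A-rawSemiring = record
    { Carrier = A ; _≈_ = _≈ₚ_ ; _+_ = _+ₚ_ ; _*_ = _*ₚ_ ; 0# = 0ₚ ; 1# = 1ₚ }

  -- divisibility (x ∣ y means ∃ z, y ≈ z * x) and irreducibility in A
  open RSDefs A-rawSemiring public using (_∣_; Irreducible)

  Monic : A → Set ℓ
  Monic p = ∃ λ d → (coeff p d ≈ 1#) ×ₚ (∀ n → d < n → coeff p n ≈ 0#)
    where open import Data.Product using () renaming (_×_ to _×ₚ_)

  q : ℕ
  q = size

  φT : A → A
  φT b = (Tₚ *ₚ b) +ₚ (b ^ₚ q)

  -- φ_a(b) for a = Σ aᵢ Tⁱ is Σ aᵢ φ_T^i(b)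
  -- (the unique F-algebra morphism a ↦ φ_a with φ_T as above)
  φ : A → A → A
  φ []      b = []
  φ (a ∷ p) b = (a ·ₚ b) +ₚ φ p (φT b)

-- (⇒) is immediate with a = P − 1.  For (⇐) write 1 = u·a + w·P (Bézout).
-- Then φ_{P−1}(1) = φ_{(P−1)u}(φ_a(1)) + φ_w(φ_P(φ_{P−1}(1))); the Carlitz
-- action preserves multiples of P², and since P ∣ φ_{P−1}(1) (the Carlitz
-- analogue of Fermat's little theorem) and φ_P(y) ≡ P·y (mod P²) whenever
-- P ∣ y, the second term is a multiple of P² as well.
--
-- The development only needs q ≥ 2.
module Submission where

open import Defs
open import Level using (Level)
open import Algebra.Bundles using (CommutativeRing)
open import Data.Nat using (_≤_)
open import Data.Nat.Properties using (≤-trans; n≤1+n)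
open import Data.Product using (∃; _×_; _,_)
open import Relation.Nullary using (¬_)
open import Function.Bundles using (_⇔_; mk⇔)

module RingIdentities {c ℓ : Level} (R : CommutativeRing c ℓ) where
  open import Data.Maybe using (nothing)
  import Relation.Binary.Reasoning.Setoid as SR
  open CommutativeRing R
  open import Algebra.Solver.Ring.NaturalCoefficients commutativeSemiring (λ _ _ → nothing) public
    using (solve; _:+_; _:*_; _:=_)
  open import Algebra.Solver.CommutativeMonoid +-commutativeMonoid as CM using (_⊕_; _⊜_)
  open import Algebra.Properties.Ring ring public using (-‿distribˡ-*; -‿distribʳ-*)
  open import Algebra.Properties.AbelianGroup +-abelianGroup public
    using (⁻¹-∙-comm; ⁻¹-anti-homo‿-; x∙y⁻¹≈ε⇒x≈y; xyx⁻¹≈y)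
  open SR setoid

  euclid-combination : ∀ a z B r g u w → a ≈ z * B + r → g ≈ u * B + w * r →
                       g ≈ w * a + (u - w * z) * B
  euclid-combination a z B r g u w ea eg = begin
    g ≈⟨ eg ⟩
    u * B + w * r ≈⟨ sym (+-identityˡ _) ⟩
    0# + (u * B + w * r) ≈⟨ +-congʳ (sym (trans (*-congʳ (-‿inverseʳ (w * z))) (zeroˡ B))) ⟩
    (w * z - w * z) * B + (u * B + w * r)
      ≈⟨ solve 6 (λ w z n B u r → ((((w :* z) :+ n) :* B) :+ ((u :* B) :+ (w :* r)))
                                   := ((w :* ((z :* B) :+ r)) :+ ((u :+ n) :* B))) refl w z (- (w * z)) B u r ⟩
    w * (z * B + r) + (u - w * z) * B ≈⟨ +-congʳ (*-congˡ (sym ea)) ⟩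
    w * a + (u - w * z) * B ∎

  euclid-divisor : ∀ a z B r g s t → a ≈ z * B + r → B ≈ s * g → r ≈ t * g → a ≈ (z * s + t) * g
  euclid-divisor a z B r g s t ea eB er = begin
    a ≈⟨ ea ⟩
    z * B + r ≈⟨ +-cong (*-congˡ eB) er ⟩
    z * (s * g) + t * g ≈⟨ solve 4 (λ z s g t → ((z :* (s :* g)) :+ (t :* g)) := (((z :* s) :+ t) :* g)) refl z s g t ⟩
    (z * s + t) * g ∎

  -- Subtraction distributes over sums, negation and products; these make
  -- "x ≡ y modulo an ideal" a congruence.
  sub-+ : ∀ x y x' y' → (x + y) - (x' + y') ≈ (x - x') + (y - y')
  sub-+ x y x' y' = trans (+-congˡ (sym (⁻¹-∙-comm x' y')))
    (CM.solve 4 (λ a b c e → ((a ⊕ b) ⊕ (c ⊕ e)) ⊜ ((a ⊕ c) ⊕ (b ⊕ e))) refl x y (- x') (- y'))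

  sub-neg : ∀ x x' → (- x) - (- x') ≈ - (x - x')
  sub-neg x x' = ⁻¹-∙-comm x (- x')

  sub-trans : ∀ x y z → x - z ≈ (x - y) + (y - z)
  sub-trans x y z = sym (begin
    (x - y) + (y - z) ≈⟨ CM.solve 4 (λ a b c e → ((a ⊕ b) ⊕ (c ⊕ e)) ⊜ ((a ⊕ e) ⊕ (b ⊕ c))) refl x (- y) y (- z) ⟩
    (x - z) + (- y + y) ≈⟨ +-congˡ (-‿inverseˡ y) ⟩
    (x - z) + 0# ≈⟨ +-identityʳ _ ⟩
    x - z ∎)

  sub-* : ∀ x y x' y' → x * y - x' * y' ≈ x * (y - y') + (x - x') * y'
  sub-* x y x' y' = sym (begin
    x * (y - y') + (x - x') * y' ≈⟨ +-cong (distribˡ x y (- y')) (distribʳ y' x (- x')) ⟩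
    (x * y + x * - y') + (x * y' + - x' * y') ≈⟨ +-cong (+-congˡ (sym (-‿distribʳ-* x y'))) (+-congˡ (sym (-‿distribˡ-* x' y'))) ⟩
    (x * y - x * y') + (x * y' - x' * y')
      ≈⟨ CM.solve 4 (λ a b c e → ((a ⊕ b) ⊕ (c ⊕ e)) ⊜ ((a ⊕ e) ⊕ (b ⊕ c))) refl (x * y) (- (x * y')) (x * y') (- (x' * y')) ⟩
    (x * y - x' * y') + (- (x * y') + x * y') ≈⟨ +-congˡ (-‿inverseˡ _) ⟩
    (x * y - x' * y') + 0# ≈⟨ +-identityʳ _ ⟩
    x * y - x' * y' ∎)

  sub-cancelˡ : ∀ a b e → (a + b) - (a + e) ≈ b - e
  sub-cancelˡ a b e = begin
    (a + b) - (a + e) ≈⟨ sub-+ a b a e ⟩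
    (a - a) + (b - e) ≈⟨ +-congʳ (-‿inverseʳ a) ⟩
    0# + (b - e) ≈⟨ +-identityˡ _ ⟩
    b - e ∎

  sub-add-cancel : ∀ x y → x ≈ (x - y) + y
  sub-add-cancel x y = begin
    x ≈⟨ sym (+-identityʳ x) ⟩
    x + 0# ≈⟨ +-congˡ (sym (-‿inverseˡ y)) ⟩
    x + (- y + y) ≈⟨ sym (+-assoc _ _ _) ⟩
    (x - y) + y ∎

  sub-split : ∀ X Y Z → X - Y ≈ (X - (Y + Z)) + Z
  sub-split X Y Z = sym (begin
    (X - (Y + Z)) + Z ≈⟨ +-congʳ (+-congˡ (sym (⁻¹-∙-comm Y Z))) ⟩
    (X + (- Y + - Z)) + Z ≈⟨ CM.solve 4 (λ a b c d → ((a ⊕ (b ⊕ c)) ⊕ d) ⊜ ((a ⊕ b) ⊕ (c ⊕ d))) refl X (- Y) (- Z) Z ⟩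
    (X - Y) + (- Z + Z) ≈⟨ +-congˡ (-‿inverseˡ Z) ⟩
    (X - Y) + 0# ≈⟨ +-identityʳ _ ⟩
    X - Y ∎)

  commutation-as-product : ∀ T c' τ c f → T * c' + f ≈ c' * τ + c → (τ - T) * c' ≈ f - c
  commutation-as-product T c' τ c f eq = begin
    (τ - T) * c' ≈⟨ sym (+-identityʳ _) ⟩
    (τ - T) * c' + 0# ≈⟨ +-congˡ (sym (-‿inverseʳ c)) ⟩
    (τ - T) * c' + (c - c)
      ≈⟨ solve 5 (λ τ nT c' c nc → (((τ :+ nT) :* c') :+ (c :+ nc)) := (((c' :* τ) :+ c) :+ ((nT :* c') :+ nc))) refl τ (- T) c' c (- c) ⟩
    (c' * τ + c) + (- T * c' + - c) ≈⟨ +-congʳ (sym eq) ⟩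
    (T * c' + f) + (- T * c' + - c)
      ≈⟨ solve 5 (λ T nT c' f nc → (((T :* c') :+ f) :+ ((nT :* c') :+ nc)) := ((f :+ nc) :+ ((T :+ nT) :* c'))) refl T (- T) c' f (- c) ⟩
    (f - c) + (T - T) * c' ≈⟨ +-congˡ (trans (*-congʳ (-‿inverseʳ T)) (zeroˡ c')) ⟩
    (f - c) + 0# ≈⟨ +-identityʳ _ ⟩
    f - c ∎

  times-pred : ∀ x z → x * (- 1# + z) ≈ x * z - x
  times-pred x z = begin
    x * (- 1# + z) ≈⟨ distribˡ x (- 1#) z ⟩
    x * - 1# + x * z ≈⟨ +-congʳ (sym (-‿distribʳ-* x 1#)) ⟩
    - (x * 1#) + x * z ≈⟨ +-congʳ (-‿cong (*-identityʳ x)) ⟩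
    - x + x * z ≈⟨ +-comm _ _ ⟩
    x * z - x ∎

  unit-from-multiple : ∀ z p → z * p ≈ p - 1# → (1# - z) * p ≈ 1#
  unit-from-multiple z p e = begin
    (1# - z) * p ≈⟨ distribʳ p 1# (- z) ⟩
    1# * p + - z * p ≈⟨ +-cong (*-identityˡ p) (sym (-‿distribˡ-* z p)) ⟩
    p - z * p ≈⟨ +-congˡ (-‿cong e) ⟩
    p - (p - 1#) ≈⟨ +-congˡ (⁻¹-anti-homo‿- p 1#) ⟩
    p + (1# - p) ≈⟨ CM.solve 3 (λ a b c → (a ⊕ (b ⊕ c)) ⊜ (b ⊕ (a ⊕ c))) refl p 1# (- p) ⟩
    1# + (p - p) ≈⟨ +-congˡ (-‿inverseʳ p) ⟩
    1# + 0# ≈⟨ +-identityʳ 1# ⟩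
    1# ∎

  bezout-scaled : ∀ e u a w p → u * a + w * p ≈ 1# → e ≈ (e * u) * a + w * (p * e)
  bezout-scaled e u a w p h = begin
    e ≈⟨ sym (*-identityʳ e) ⟩
    e * 1# ≈⟨ *-congˡ (sym h) ⟩
    e * (u * a + w * p) ≈⟨ solve 5 (λ e u a w p → (e :* ((u :* a) :+ (w :* p))) := (((e :* u) :* a) :+ (w :* (p :* e)))) refl e u a w p ⟩
    (e * u) * a + w * (p * e) ∎

-- Polynomials are plain coefficient lists (lowest
-- degree first) evaluated by Horner's rule; the argument is the usual one,
-- dividing out the linear factor (X − r) of a root r.
module RootBound {c ℓ : Level} (R : CommutativeRing c ℓ) where
  open import Data.Nat using (zero; suc)
  open import Data.Nat.Properties using () renaming (suc-injective to ℕ-suc-injective)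
  open import Data.Fin using (Fin) renaming (zero to fz; suc to fs)
  open import Data.Fin.Properties using (0≢1+n; suc-injective)
  open import Data.List using (List; []; _∷_; length)
  open import Data.Maybe using (nothing)
  open import Relation.Nullary using (¬_)
  open import Data.Empty using (⊥)
  open import Relation.Binary.PropositionalEquality as P using (_≡_)
  open import Tactic.RingSolver.Core.AlmostCommutativeRing using (fromCommutativeRing)
  import Relation.Binary.Reasoning.Setoid as SR
  open CommutativeRing R renaming (Carrier to C)
  open RingIdentities R using (sub-add-cancel)
  open SR setoid
  open import Tactic.RingSolver.NonReflective (fromCommutativeRing R (λ _ → nothing)) using (solve; _⊕_; _⊗_; _⊜_)

  eval : List C → C → C
  eval [] x = 0#
  eval (a ∷ p) x = a + x * eval p x

  lastCoeff : List C → C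
  lastCoeff [] = 0#
  lastCoeff (a ∷ []) = a
  lastCoeff (a ∷ b ∷ p) = lastCoeff (b ∷ p)

  -- synthetic division: the quotient of g by (X − c)
  deflate : C → List C → List C
  deflate c [] = []
  deflate c (a ∷ []) = []
  deflate c (a ∷ b ∷ p) = eval (b ∷ p) c ∷ deflate c (b ∷ p)

  deflate-spec : ∀ c g x → eval g x ≈ (x - c) * eval (deflate c g) x + eval g c
  deflate-spec c [] x = sym (trans (+-identityʳ _) (zeroʳ _))
  deflate-spec c (a ∷ []) x = begin
    a + x * 0# ≈⟨ +-congˡ (zeroʳ x) ⟩
    a + 0# ≈⟨ +-congˡ (sym (zeroʳ c)) ⟩
    a + c * 0# ≈⟨ sym (+-identityˡ _) ⟩
    0# + (a + c * 0#) ≈⟨ +-congʳ (sym (zeroʳ _)) ⟩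
    (x - c) * 0# + (a + c * 0#) ∎
  deflate-spec c (a ∷ b ∷ p) x = begin
    a + x * eval (b ∷ p) x ≈⟨ +-congˡ (*-congˡ (deflate-spec c (b ∷ p) x)) ⟩
    a + x * (d * E + H) ≈⟨ +-congˡ (*-congʳ (sub-add-cancel x c)) ⟩
    a + (d + c) * (d * E + H)
      ≈⟨ solve 5 (λ a d c E H → (a ⊕ ((d ⊕ c) ⊗ ((d ⊗ E) ⊕ H))) ⊜ ((d ⊗ (H ⊕ ((d ⊕ c) ⊗ E))) ⊕ (a ⊕ (c ⊗ H)))) refl a d c E H ⟩
    d * (H + (d + c) * E) + (a + c * H) ≈⟨ +-congʳ (*-congˡ (+-congˡ (*-congʳ (sym (sub-add-cancel x c))))) ⟩
    d * (H + x * E) + (a + c * H) ∎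
    where
    d = x - c
    E = eval (deflate c (b ∷ p)) x
    H = eval (b ∷ p) c

  lastCoeff-deflate : ∀ c a b p → lastCoeff (deflate c (a ∷ b ∷ p)) ≈ lastCoeff (b ∷ p)
  lastCoeff-deflate c a b [] = trans (+-congˡ (zeroʳ c)) (+-identityʳ b)
  lastCoeff-deflate c a b (b' ∷ p) = lastCoeff-deflate c b b' p

  length-deflate : ∀ c a b p → length (deflate c (a ∷ b ∷ p)) ≡ length (b ∷ p)
  length-deflate c a b [] = P.refl
  length-deflate c a b (b' ∷ p) = P.cong suc (length-deflate c b b' p)

  module _ (1≉0 : ¬ (1# ≈ 0#))
           (no-zero-divisors : ∀ x y → ¬ (x ≈ 0#) → x * y ≈ 0# → y ≈ 0#) where

    sub-nonzero : ∀ {x y} → ¬ (x ≈ y) → ¬ (x - y ≈ 0#)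
    sub-nonzero {x} {y} ne e = ne (trans (sub-add-cancel x y) (trans (+-congʳ e) (+-identityˡ y)))

    too-many-roots : ∀ n (g : List C) → length g ≡ suc n → lastCoeff g ≈ 1# →
                     (r : Fin (suc n) → C) → (∀ i j → r i ≈ r j → i ≡ j) →
                     (∀ i → eval g (r i) ≈ 0#) → ⊥
    too-many-roots zero (a ∷ []) P.refl l r inj z =
      1≉0 (trans (sym l) (trans (sym (+-identityʳ a)) (trans (+-congˡ (sym (zeroʳ _))) (z fz))))
    too-many-roots (suc n) (a ∷ b ∷ p) len l r inj z =
      too-many-roots n (deflate r₀ (a ∷ b ∷ p)) (P.trans (length-deflate r₀ a b p) (ℕ-suc-injective len))
        (trans (lastCoeff-deflate r₀ a b p) l)
        (λ i → r (fs i)) (λ i j e → suc-injective (inj (fs i) (fs j) e)) deflated-roots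
      where
      r₀ = r fz
      -- the other roots are roots of the deflated polynomial, since r i − r₀ ≠ 0
      deflated-roots : ∀ i → eval (deflate r₀ (a ∷ b ∷ p)) (r (fs i)) ≈ 0#
      deflated-roots i = no-zero-divisors _ _ (sub-nonzero (λ e → 0≢1+n (inj fz (fs i) (sym e))))
        (trans (sym (+-identityʳ _)) (trans (+-congˡ (sym (z fz)))
          (trans (sym (deflate-spec r₀ (a ∷ b ∷ p) (r (fs i)))) (z (fs i)))))

module PolyRing {c ℓ : Level} (F : FiniteField c ℓ) where
  open import Level using (_⊔_)
  open import Algebra.Bundles using (CommutativeMonoid)
  open import Data.Nat using (zero; suc; s≤s)
  open import Data.List using ([]; _∷_; length)
  open import Data.Product using (Σ; _,_)
  import Relation.Binary.Reasoning.Setoid as SR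
  open FiniteField F renaming (Carrier to K) hiding (zero)
  open Poly F
  open SR setoid
  open import Algebra.Properties.AbelianGroup +-abelianGroup public using () renaming (ε⁻¹≈ε to -0#≈0#)

  -- Coefficientwise equality of polynomials, wrapped in a record so that
  -- its two arguments can be inferred from a proof.
  infix 4 _≋_
  record _≋_ (p r : A) : Set ℓ where
    constructor mk
    field get : p ≈ₚ r
  open _≋_ public

  ≈ₚ-refl : ∀ {p} → p ≋ p
  ≈ₚ-refl = mk λ n → refl
  ≈ₚ-sym : ∀ {p r} → p ≋ r → r ≋ p
  ≈ₚ-sym (mk e) = mk λ n → sym (e n)
  ≈ₚ-trans : ∀ {p r s} → p ≋ r → r ≋ s → p ≋ s
  ≈ₚ-trans (mk e) (mk f) = mk λ n → trans (e n) (f n)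

  ∷-cong : ∀ {a b p r} → a ≈ b → p ≋ r → (a ∷ p) ≋ (b ∷ r)
  ∷-cong e f = mk λ { zero → e ; (suc n) → get f n }

  coeff-+ : ∀ p r n → coeff (p +ₚ r) n ≈ coeff p n + coeff r n
  coeff-+ [] r n = sym (+-identityˡ _)
  coeff-+ (a ∷ p) [] n = sym (+-identityʳ _)
  coeff-+ (a ∷ p) (b ∷ r) zero = refl
  coeff-+ (a ∷ p) (b ∷ r) (suc n) = coeff-+ p r n

  coeff-neg : ∀ p n → coeff (-ₚ p) n ≈ - coeff p n
  coeff-neg [] n = sym -0#≈0#
  coeff-neg (a ∷ p) zero = refl
  coeff-neg (a ∷ p) (suc n) = coeff-neg p n

  coeff-· : ∀ a p n → coeff (a ·ₚ p) n ≈ a * coeff p n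
  coeff-· a [] n = sym (zeroʳ a)
  coeff-· a (b ∷ p) zero = refl
  coeff-· a (b ∷ p) (suc n) = coeff-· a p n

  +ₚ-cong : ∀ {p p' r r'} → p ≋ p' → r ≋ r' → (p +ₚ r) ≋ (p' +ₚ r')
  +ₚ-cong {p} {p'} {r} {r'} e f = mk λ n → trans (coeff-+ p r n) (trans (+-cong (get e n) (get f n)) (sym (coeff-+ p' r' n)))

  -ₚ-cong : ∀ {p p'} → p ≋ p' → (-ₚ p) ≋ (-ₚ p')
  -ₚ-cong {p} {p'} e = mk λ n → trans (coeff-neg p n) (trans (-‿cong (get e n)) (sym (coeff-neg p' n)))

  ·ₚ-cong : ∀ {a b p p'} → a ≈ b → p ≋ p' → (a ·ₚ p) ≋ (b ·ₚ p')
  ·ₚ-cong {a} {b} {p} {p'} e f = mk λ n → trans (coeff-· a p n) (trans (*-cong e (get f n)) (sym (coeff-· b p' n)))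

  +ₚ-comm : ∀ p r → (p +ₚ r) ≋ (r +ₚ p)
  +ₚ-comm p r = mk λ n → trans (coeff-+ p r n) (trans (+-comm _ _) (sym (coeff-+ r p n)))

  +ₚ-assoc : ∀ p r s → ((p +ₚ r) +ₚ s) ≋ (p +ₚ (r +ₚ s))
  +ₚ-assoc p r s = mk λ n → begin
    coeff ((p +ₚ r) +ₚ s) n ≈⟨ coeff-+ (p +ₚ r) s n ⟩
    coeff (p +ₚ r) n + coeff s n ≈⟨ +-congʳ (coeff-+ p r n) ⟩
    (coeff p n + coeff r n) + coeff s n ≈⟨ +-assoc _ _ _ ⟩
    coeff p n + (coeff r n + coeff s n) ≈⟨ +-congˡ (sym (coeff-+ r s n)) ⟩
    coeff p n + coeff (r +ₚ s) n ≈⟨ sym (coeff-+ p (r +ₚ s) n) ⟩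
    coeff (p +ₚ (r +ₚ s)) n ∎

  +ₚ-identityˡ : ∀ p → ([] +ₚ p) ≋ p
  +ₚ-identityˡ p = ≈ₚ-refl
  +ₚ-identityʳ : ∀ p → (p +ₚ []) ≋ p
  +ₚ-identityʳ p = mk λ n → trans (coeff-+ p [] n) (+-identityʳ _)

  -ₚ-inverseˡ : ∀ p → ((-ₚ p) +ₚ p) ≋ []
  -ₚ-inverseˡ p = mk λ n → trans (coeff-+ (-ₚ p) p n) (trans (+-congʳ (coeff-neg p n)) (-‿inverseˡ _))
  -ₚ-inverseʳ : ∀ p → (p +ₚ (-ₚ p)) ≋ []
  -ₚ-inverseʳ p = mk λ n → trans (coeff-+ p (-ₚ p) n) (trans (+-congˡ (coeff-neg p n)) (-‿inverseʳ _))

  ·-distribˡ : ∀ a p r → (a ·ₚ (p +ₚ r)) ≋ ((a ·ₚ p) +ₚ (a ·ₚ r))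
  ·-distribˡ a p r = mk λ n → begin
    coeff (a ·ₚ (p +ₚ r)) n ≈⟨ coeff-· a (p +ₚ r) n ⟩
    a * coeff (p +ₚ r) n ≈⟨ *-congˡ (coeff-+ p r n) ⟩
    a * (coeff p n + coeff r n) ≈⟨ distribˡ _ _ _ ⟩
    a * coeff p n + a * coeff r n ≈⟨ +-cong (sym (coeff-· a p n)) (sym (coeff-· a r n)) ⟩
    coeff (a ·ₚ p) n + coeff (a ·ₚ r) n ≈⟨ sym (coeff-+ (a ·ₚ p) (a ·ₚ r) n) ⟩
    coeff ((a ·ₚ p) +ₚ (a ·ₚ r)) n ∎

  ·-distribʳ : ∀ a b p → ((a + b) ·ₚ p) ≋ ((a ·ₚ p) +ₚ (b ·ₚ p))
  ·-distribʳ a b p = mk λ n → begin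
    coeff ((a + b) ·ₚ p) n ≈⟨ coeff-· (a + b) p n ⟩
    (a + b) * coeff p n ≈⟨ distribʳ _ _ _ ⟩
    a * coeff p n + b * coeff p n ≈⟨ +-cong (sym (coeff-· a p n)) (sym (coeff-· b p n)) ⟩
    coeff (a ·ₚ p) n + coeff (b ·ₚ p) n ≈⟨ sym (coeff-+ (a ·ₚ p) (b ·ₚ p) n) ⟩
    coeff ((a ·ₚ p) +ₚ (b ·ₚ p)) n ∎

  ·-assoc : ∀ a b p → (a ·ₚ (b ·ₚ p)) ≋ ((a * b) ·ₚ p)
  ·-assoc a b p = mk λ n → begin
    coeff (a ·ₚ (b ·ₚ p)) n ≈⟨ coeff-· a (b ·ₚ p) n ⟩
    a * coeff (b ·ₚ p) n ≈⟨ *-congˡ (coeff-· b p n) ⟩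
    a * (b * coeff p n) ≈⟨ sym (*-assoc _ _ _) ⟩
    (a * b) * coeff p n ≈⟨ sym (coeff-· (a * b) p n) ⟩
    coeff ((a * b) ·ₚ p) n ∎

  ·-one : ∀ p → (1# ·ₚ p) ≋ p
  ·-one p = mk λ n → trans (coeff-· 1# p n) (*-identityˡ _)

  ·-zero : ∀ p → (0# ·ₚ p) ≋ []
  ·-zero p = mk λ n → trans (coeff-· 0# p n) (zeroˡ _)

  0∷-+ : ∀ p r → (0# ∷ (p +ₚ r)) ≋ ((0# ∷ p) +ₚ (0# ∷ r))
  0∷-+ p r = ∷-cong (sym (+-identityˡ 0#)) ≈ₚ-refl

  0∷-[] : (0# ∷ []) ≋ []
  0∷-[] = mk λ { zero → refl ; (suc n) → refl }

  0∷-cong : ∀ {p r} → p ≋ r → (0# ∷ p) ≋ (0# ∷ r)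
  0∷-cong e = ∷-cong refl e

  zero-tail : ∀ {a p} → (a ∷ p) ≋ [] → p ≋ []
  zero-tail e = mk λ n → get e (suc n)
  zero-head : ∀ {a p} → (a ∷ p) ≋ [] → a ≈ 0#
  zero-head e = get e zero

  ·-on-zero : ∀ a {p} → p ≋ [] → (a ·ₚ p) ≋ []
  ·-on-zero a {p} e = mk λ n → trans (coeff-· a p n) (trans (*-congˡ (get e n)) (zeroʳ a))

  *-zeroˡ : ∀ {p} r → p ≋ [] → (p *ₚ r) ≋ []
  *-zeroˡ {[]} r e = ≈ₚ-refl
  *-zeroˡ {a ∷ p} r e =
    ≈ₚ-trans (+ₚ-cong (mk λ n → trans (coeff-· a r n) (trans (*-congʳ (zero-head e)) (zeroˡ _)))
                      (≈ₚ-trans (0∷-cong (*-zeroˡ r (zero-tail e))) 0∷-[])) (+ₚ-identityʳ [])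

  *-congˡ' : ∀ {p p'} r → p ≋ p' → (p *ₚ r) ≋ (p' *ₚ r)
  *-congˡ' {[]} {p'} r e = ≈ₚ-sym (*-zeroˡ r (≈ₚ-sym e))
  *-congˡ' {a ∷ p} {[]} r e = *-zeroˡ r e
  *-congˡ' {a ∷ p} {b ∷ p'} r e = +ₚ-cong (·ₚ-cong (get e zero) ≈ₚ-refl) (0∷-cong (*-congˡ' {p} {p'} r (mk λ n → get e (suc n))))

  *-congʳ' : ∀ p {r r'} → r ≋ r' → (p *ₚ r) ≋ (p *ₚ r')
  *-congʳ' [] e = ≈ₚ-refl
  *-congʳ' (a ∷ p) e = +ₚ-cong (·ₚ-cong refl e) (0∷-cong (*-congʳ' p e))

  *ₚ-cong : ∀ {p p' r r'} → p ≋ p' → r ≋ r' → (p *ₚ r) ≋ (p' *ₚ r')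
  *ₚ-cong {p} {p'} {r} {r'} e f = ≈ₚ-trans (*-congˡ' r e) (*-congʳ' p' f)

  +ₚ-cm : CommutativeMonoid c ℓ
  +ₚ-cm = record
    { Carrier = A ; _≈_ = _≋_ ; _∙_ = _+ₚ_ ; ε = []
    ; isCommutativeMonoid = record
      { isMonoid = record
        { isSemigroup = record
          { isMagma = record
            { isEquivalence = record { refl = ≈ₚ-refl ; sym = ≈ₚ-sym ; trans = ≈ₚ-trans }
            ; ∙-cong = +ₚ-cong }
          ; assoc = +ₚ-assoc }
        ; identity = +ₚ-identityˡ , +ₚ-identityʳ }
      ; comm = +ₚ-comm } }

  open import Algebra.Solver.CommutativeMonoid +ₚ-cm as CMS using (_⊕_; _⊜_)

  swap-mid : ∀ w x y z → ((w +ₚ x) +ₚ (y +ₚ z)) ≋ ((w +ₚ y) +ₚ (x +ₚ z))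
  swap-mid = CMS.solve 4 (λ w x y z → ((w ⊕ x) ⊕ (y ⊕ z)) ⊜ ((w ⊕ y) ⊕ (x ⊕ z))) ≈ₚ-refl

  *-distribˡ : ∀ p r s → (p *ₚ (r +ₚ s)) ≋ ((p *ₚ r) +ₚ (p *ₚ s))
  *-distribˡ [] r s = ≈ₚ-refl
  *-distribˡ (a ∷ p) r s = ≈ₚ-trans
    (+ₚ-cong (·-distribˡ a r s) (≈ₚ-trans (0∷-cong (*-distribˡ p r s)) (0∷-+ (p *ₚ r) (p *ₚ s))))
    (swap-mid (a ·ₚ r) (a ·ₚ s) (0# ∷ (p *ₚ r)) (0# ∷ (p *ₚ s)))

  *-distribʳ : ∀ p r s → ((p +ₚ r) *ₚ s) ≋ ((p *ₚ s) +ₚ (r *ₚ s))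
  *-distribʳ [] r s = ≈ₚ-refl
  *-distribʳ (a ∷ p) [] s = ≈ₚ-sym (+ₚ-identityʳ _)
  *-distribʳ (a ∷ p) (b ∷ r) s = ≈ₚ-trans
    (+ₚ-cong (·-distribʳ a b s) (≈ₚ-trans (0∷-cong (*-distribʳ p r s)) (0∷-+ (p *ₚ s) (r *ₚ s))))
    (swap-mid (a ·ₚ s) (b ·ₚ s) (0# ∷ (p *ₚ s)) (0# ∷ (r *ₚ s)))

  ·-*ˡ : ∀ a p r → ((a ·ₚ p) *ₚ r) ≋ (a ·ₚ (p *ₚ r))
  ·-*ˡ a [] r = ≈ₚ-refl
  ·-*ˡ a (b ∷ p) r = ≈ₚ-trans (+ₚ-cong (≈ₚ-sym (·-assoc a b r)) (≈ₚ-trans (0∷-cong (·-*ˡ a p r)) (∷-cong (sym (zeroʳ a)) ≈ₚ-refl)))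
    (≈ₚ-sym (·-distribˡ a (b ·ₚ r) (0# ∷ (p *ₚ r))))

  ·-*ʳ : ∀ a p r → (p *ₚ (a ·ₚ r)) ≋ (a ·ₚ (p *ₚ r))
  ·-*ʳ a [] r = ≈ₚ-refl
  ·-*ʳ a (b ∷ p) r = ≈ₚ-trans (+ₚ-cong (≈ₚ-trans (·-assoc b a r) (≈ₚ-trans (·ₚ-cong (*-comm b a) ≈ₚ-refl) (≈ₚ-sym (·-assoc a b r))))
       (≈ₚ-trans (0∷-cong (·-*ʳ a p r)) (∷-cong (sym (zeroʳ a)) ≈ₚ-refl)))
    (≈ₚ-sym (·-distribˡ a (b ·ₚ r) (0# ∷ (p *ₚ r))))

  0∷-*ˡ : ∀ p r → ((0# ∷ p) *ₚ r) ≋ (0# ∷ (p *ₚ r))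
  0∷-*ˡ p r = ≈ₚ-trans (+ₚ-cong (·-zero r) ≈ₚ-refl) (+ₚ-identityˡ _)

  *-identityˡ' : ∀ p → (1ₚ *ₚ p) ≋ p
  *-identityˡ' p = ≈ₚ-trans (+ₚ-cong (·-one p) 0∷-[]) (+ₚ-identityʳ p)

  *-∷ʳ : ∀ r a p → (r *ₚ (a ∷ p)) ≋ ((a ·ₚ r) +ₚ (0# ∷ (r *ₚ p)))
  *-∷ʳ [] a p = ≈ₚ-sym (≈ₚ-trans (+ₚ-identityˡ _) 0∷-[])
  *-∷ʳ (b ∷ r) a p = mk λ { zero → constant-coeff ; (suc n) → higher-coeff n }
    where
    constant-coeff : coeff ((b ·ₚ (a ∷ p)) +ₚ (0# ∷ (r *ₚ (a ∷ p)))) zero ≈ coeff ((a ·ₚ (b ∷ r)) +ₚ (0# ∷ ((b ∷ r) *ₚ p))) zero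
    constant-coeff = trans (coeff-+ (b ·ₚ (a ∷ p)) (0# ∷ (r *ₚ (a ∷ p))) zero) (trans (+-cong (*-comm b a) refl) (sym (coeff-+ (a ·ₚ (b ∷ r)) (0# ∷ ((b ∷ r) *ₚ p)) zero)))
    tails : ((b ·ₚ p) +ₚ (r *ₚ (a ∷ p))) ≋ ((a ·ₚ r) +ₚ ((b ·ₚ p) +ₚ (0# ∷ (r *ₚ p))))
    tails = ≈ₚ-trans (+ₚ-cong ≈ₚ-refl (*-∷ʳ r a p))
         (CMS.solve 3 (λ x y z → (x ⊕ (y ⊕ z)) ⊜ (y ⊕ (x ⊕ z))) ≈ₚ-refl (b ·ₚ p) (a ·ₚ r) (0# ∷ (r *ₚ p)))
    higher-coeff : ∀ n → coeff ((b ·ₚ (a ∷ p)) +ₚ (0# ∷ (r *ₚ (a ∷ p)))) (suc n) ≈ coeff ((a ·ₚ (b ∷ r)) +ₚ (0# ∷ ((b ∷ r) *ₚ p))) (suc n)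
    higher-coeff n = begin
      coeff ((b ·ₚ (a ∷ p)) +ₚ (0# ∷ (r *ₚ (a ∷ p)))) (suc n) ≈⟨ coeff-+ (b ·ₚ (a ∷ p)) (0# ∷ (r *ₚ (a ∷ p))) (suc n) ⟩
      coeff (b ·ₚ p) n + coeff (r *ₚ (a ∷ p)) n ≈⟨ sym (coeff-+ (b ·ₚ p) (r *ₚ (a ∷ p)) n) ⟩
      coeff ((b ·ₚ p) +ₚ (r *ₚ (a ∷ p))) n ≈⟨ get tails n ⟩
      coeff ((a ·ₚ r) +ₚ ((b ·ₚ p) +ₚ (0# ∷ (r *ₚ p)))) n ≈⟨ coeff-+ (a ·ₚ r) _ n ⟩
      coeff (a ·ₚ r) n + coeff ((b ·ₚ p) +ₚ (0# ∷ (r *ₚ p))) n ≈⟨ sym (coeff-+ (a ·ₚ (b ∷ r)) (0# ∷ ((b ∷ r) *ₚ p)) (suc n)) ⟩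
      coeff ((a ·ₚ (b ∷ r)) +ₚ (0# ∷ ((b ∷ r) *ₚ p))) (suc n) ∎

  *ₚ-comm : ∀ p r → (p *ₚ r) ≋ (r *ₚ p)
  *ₚ-comm [] r = ≈ₚ-sym (*-zeroʳ' r)
    where
    *-zeroʳ' : ∀ r → (r *ₚ []) ≋ []
    *-zeroʳ' [] = ≈ₚ-refl
    *-zeroʳ' (a ∷ r) = ≈ₚ-trans (+ₚ-identityˡ _) (≈ₚ-trans (0∷-cong (*-zeroʳ' r)) 0∷-[])
  *ₚ-comm (a ∷ p) r = ≈ₚ-sym (≈ₚ-trans (*-∷ʳ r a p) (+ₚ-cong ≈ₚ-refl (0∷-cong (*ₚ-comm r p))))

  *ₚ-assoc : ∀ p r s → ((p *ₚ r) *ₚ s) ≋ (p *ₚ (r *ₚ s))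
  *ₚ-assoc [] r s = ≈ₚ-refl
  *ₚ-assoc (a ∷ p) r s = ≈ₚ-trans (*-distribʳ (a ·ₚ r) (0# ∷ (p *ₚ r)) s)
    (+ₚ-cong (·-*ˡ a r s) (≈ₚ-trans (0∷-*ˡ (p *ₚ r) s) (0∷-cong (*ₚ-assoc p r s))))

  Aring : CommutativeRing c ℓ
  Aring = record
    { Carrier = A ; _≈_ = _≋_ ; _+_ = _+ₚ_ ; _*_ = _*ₚ_ ; -_ = -ₚ_ ; 0# = [] ; 1# = 1ₚ
    ; isCommutativeRing = record
      { isRing = record
        { +-isAbelianGroup = record
          { isGroup = record
            { isMonoid = CommutativeMonoid.isMonoid +ₚ-cm
            ; inverse = -ₚ-inverseˡ , -ₚ-inverseʳ
            ; ⁻¹-cong = -ₚ-cong }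
          ; comm = +ₚ-comm }
        ; *-cong = *ₚ-cong
        ; *-assoc = *ₚ-assoc
        ; *-identity = *-identityˡ' , (λ p → ≈ₚ-trans (*ₚ-comm p 1ₚ) (*-identityˡ' p))
        ; distrib = *-distribˡ , (λ s p r → *-distribʳ p r s) }
      ; *-comm = *ₚ-comm } }

  module AR = CommutativeRing Aring
  module G = RingIdentities Aring

  +ₚ-congˡ : ∀ p {r r'} → r ≋ r' → (p +ₚ r) ≋ (p +ₚ r')
  +ₚ-congˡ p e = +ₚ-cong {p} {p} ≈ₚ-refl e
  +ₚ-congʳ : ∀ {p p'} r → p ≋ p' → (p +ₚ r) ≋ (p' +ₚ r)
  +ₚ-congʳ r e = +ₚ-cong {r = r} {r' = r} e ≈ₚ-refl
  *ₚ-congˡ : ∀ p {r r'} → r ≋ r' → (p *ₚ r) ≋ (p *ₚ r')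
  *ₚ-congˡ p e = *ₚ-cong {p} {p} ≈ₚ-refl e
  *ₚ-congʳ : ∀ {p p'} r → p ≋ p' → (p *ₚ r) ≋ (p' *ₚ r)
  *ₚ-congʳ r e = *ₚ-cong {r = r} {r' = r} e ≈ₚ-refl

  T*-shift : ∀ p → (Tₚ *ₚ p) ≋ (0# ∷ p)
  T*-shift p = ≈ₚ-trans (+ₚ-cong (·-zero p) (0∷-cong (*-identityˡ' p))) (+ₚ-identityˡ _)

  cons-split : ∀ a p → (a ∷ p) ≋ ((a ∷ []) +ₚ (0# ∷ p))
  cons-split a p = ∷-cong (sym (+-identityʳ a)) ≈ₚ-refl

  cons-as-T : ∀ a p → (a ∷ p) ≋ ((a ∷ []) +ₚ (Tₚ *ₚ p))
  cons-as-T a p = ≈ₚ-trans (cons-split a p) (+ₚ-congˡ (a ∷ []) (≈ₚ-sym (T*-shift p)))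

  ·-as-* : ∀ a x → (a ·ₚ x) ≋ ((a ∷ []) *ₚ x)
  ·-as-* a x = ≈ₚ-sym (≈ₚ-trans (+ₚ-cong ≈ₚ-refl 0∷-[]) (+ₚ-identityʳ _))

  coeff-beyond : ∀ p n → length p ≤ n → coeff p n ≈ 0#
  coeff-beyond [] n _ = refl
  coeff-beyond (a ∷ p) (suc n) (s≤s le) = coeff-beyond p n le

  infix 4 _∣′_
  _∣′_ : A → A → Set (c ⊔ ℓ)
  x ∣′ y = Σ A (λ z → (z *ₚ x) ≋ y)

  ∣⇒∣′ : ∀ {x y} → x ∣ y → x ∣′ y
  ∣⇒∣′ record { quotient = z ; equality = e } = z , mk e

  ∣′⇒∣ : ∀ {x y} → x ∣′ y → x ∣ y
  ∣′⇒∣ (z , e) = record { quotient = z ; equality = get e }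

  module Multiples (X : A) where
    dv0 : X ∣′ []
    dv0 = [] , ≈ₚ-refl

    dv-cong : ∀ {a b} → a ≋ b → X ∣′ a → X ∣′ b
    dv-cong e (z , ez) = z , AR.trans ez e

    dv-+ : ∀ {a b} → X ∣′ a → X ∣′ b → X ∣′ (a +ₚ b)
    dv-+ (z , ez) (w , ew) = (z +ₚ w) , AR.trans (AR.distribʳ X z w) (+ₚ-cong ez ew)

    dv-neg : ∀ {a} → X ∣′ a → X ∣′ (-ₚ a)
    dv-neg (z , ez) = (-ₚ z) , AR.trans (AR.sym (G.-‿distribˡ-* z X)) (-ₚ-cong ez)

    dv-* : ∀ c {a} → X ∣′ a → X ∣′ (c *ₚ a)
    dv-* c (z , ez) = (c *ₚ z) , AR.trans (AR.*-assoc c z X) (*ₚ-congˡ c ez)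

    dv-*r : ∀ c {a} → X ∣′ a → X ∣′ (a *ₚ c)
    dv-*r c {a} h = dv-cong (AR.*-comm c a) (dv-* c h)

    dv-self : ∀ c → X ∣′ (c *ₚ X)
    dv-self c = c , ≈ₚ-refl

-- For Fermat, let u(y) = y for y ≠ 0 and u(0) = 1; for
-- x ≠ 0, y ↦ x·y permutes F, so ∏ u(x·y) = ∏ u(y), and comparing with
-- ∏ x·u(y) = x^q·∏ u(y) (correcting for the single y = 0) gives x^q = x.
module FieldFacts {c ℓ : Level} (F : FiniteField c ℓ) where
  open import Data.Nat using (ℕ; zero; suc; _≤_; s≤s)
  open import Data.Fin using (Fin; punchIn) renaming (zero to fz; suc to fs)
  open import Data.Fin.Properties using (punchInᵢ≢i) renaming (_≟_ to _≟F_)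
  import Data.Fin.Permutation as Perm
  open import Data.Product using (proj₁; proj₂)
  open import Relation.Nullary using (¬_; Dec; yes; no)
  open import Data.Empty using (⊥-elim)
  open import Relation.Binary.PropositionalEquality as P using (_≡_)
  import Relation.Binary.Reasoning.Setoid as SR
  open FiniteField F renaming (Carrier to K) hiding (zero)
  open SR setoid

  idx : K → Fin size
  idx x = proj₁ (enum-sur x)

  enum-idx : ∀ x → enum (idx x) ≈ x
  enum-idx x = proj₂ (enum-sur x)

  idx-cong : ∀ {x y} → x ≈ y → idx x ≡ idx y
  idx-cong {x} {y} e = enum-inj _ _ (trans (enum-idx x) (trans e (sym (enum-idx y))))

  idx-enum : ∀ i → idx (enum i) ≡ i
  idx-enum i = enum-inj _ _ (enum-idx (enum i))

  _≟_ : (x y : K) → Dec (x ≈ y)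
  x ≟ y with idx x ≟F idx y
  ... | yes e = yes (trans (sym (enum-idx x)) (trans (reflexive (P.cong enum e)) (enum-idx y)))
  ... | no ne = no λ e → ne (idx-cong e)

  inv : (x : K) → ¬ (x ≈ 0#) → K
  inv x nz = proj₁ (inverse x nz)

  inv-r : ∀ x (nz : ¬ (x ≈ 0#)) → x * inv x nz ≈ 1#
  inv-r x nz = proj₂ (inverse x nz)

  cancelˡ : ∀ x {y z} → ¬ (x ≈ 0#) → x * y ≈ x * z → y ≈ z
  cancelˡ x {y} {z} nz e = begin
    y ≈⟨ sym (*-identityˡ y) ⟩
    1# * y ≈⟨ *-congʳ (sym (trans (*-comm _ _) (inv-r x nz))) ⟩
    (inv x nz * x) * y ≈⟨ *-assoc _ _ _ ⟩
    inv x nz * (x * y) ≈⟨ *-congˡ e ⟩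
    inv x nz * (x * z) ≈⟨ sym (*-assoc _ _ _) ⟩
    (inv x nz * x) * z ≈⟨ *-congʳ (trans (*-comm _ _) (inv-r x nz)) ⟩
    1# * z ≈⟨ *-identityˡ z ⟩
    z ∎

  nz*nz : ∀ {x y} → ¬ (x ≈ 0#) → ¬ (y ≈ 0#) → ¬ (x * y ≈ 0#)
  nz*nz {x} {y} nx ny e = ny (cancelˡ x nx (trans e (sym (zeroʳ x))))

  open import Algebra.Properties.CommutativeMonoid.Sum *-commutativeMonoid
    using (sum-permute; sum-remove; ∑-distrib-+; sum-cong-≋; sum-replicate; sum-replicate-zero)
    renaming (sum to product)
  open import Algebra.Definitions.RawMonoid *-rawMonoid
    using () renaming (_×_ to _×ᵐ_)

  pw : K → ℕ → K
  pw x n = n ×ᵐ x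

  product-scale : ∀ {n} x (f : Fin n → K) → product (λ i → x * f i) ≈ pw x n * product f
  product-scale {n} x f = trans (∑-distrib-+ (λ _ → x) f) (*-congʳ (sum-replicate n))

  product-nz : ∀ {n} (f : Fin n → K) → (∀ i → ¬ (f i ≈ 0#)) → ¬ (product f ≈ 0#)
  product-nz {zero} f e = λ z → 0≉1 (sym z)
  product-nz {suc n} f e = nz*nz (e fz) (product-nz (λ i → f (fs i)) (λ i → e (fs i)))

  u : K → K
  u y with y ≟ 0#
  ... | yes _ = 1#
  ... | no _ = y

  u-nz : ∀ y → ¬ (u y ≈ 0#)
  u-nz y with y ≟ 0#
  ... | yes _ = λ e → 0≉1 (sym e)
  ... | no ne = ne

  u-cong : ∀ {x y} → x ≈ y → u x ≈ u y
  u-cong {x} {y} e with x ≟ 0# | y ≟ 0#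
  ... | yes _ | yes _ = refl
  ... | yes a | no b = ⊥-elim (b (trans (sym e) a))
  ... | no a | yes b = ⊥-elim (a (trans e b))
  ... | no _ | no _ = e

  module _ (x : K) (x≠0 : ¬ (x ≈ 0#)) where
    -- the correction factor k y = 1 for y ≠ 0 and k 0 = x, so that u(x·y)·k(y) = x·u(y)
    k : K → K
    k y with y ≟ 0#
    ... | yes _ = x
    ... | no _ = 1#

    u-scale : ∀ y → u (x * y) * k y ≈ x * u y
    u-scale y with y ≟ 0# | (x * y) ≟ 0#
    ... | yes a | yes b = trans (*-identityˡ x) (sym (*-identityʳ x))
    ... | yes a | no b = ⊥-elim (b (trans (*-congˡ a) (zeroʳ x)))
    ... | no a | yes b = ⊥-elim (nz*nz x≠0 a b)
    ... | no a | no b = *-identityʳ _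

    product-k : ∀ {n} (e : Fin n → K) (i₀ : Fin n) → e i₀ ≈ 0# → (∀ j → e j ≈ 0# → j ≡ i₀) →
                product (λ i → k (e i)) ≈ x
    product-k {suc n} e i₀ z₀ unique =
      trans (sum-remove {i = i₀} (λ i → k (e i)))
            (trans (*-cong (k-zero (e i₀) z₀) (trans (sum-cong-≋ others) (sum-replicate-zero n))) (*-identityʳ x))
      where
      k-zero : ∀ y → y ≈ 0# → k y ≈ x
      k-zero y z with y ≟ 0#
      ... | yes _ = refl
      ... | no nz = ⊥-elim (nz z)
      others : ∀ j → k (e (punchIn i₀ j)) ≈ 1#
      others j with e (punchIn i₀ j) ≟ 0#
      ... | yes z = ⊥-elim (punchInᵢ≢i i₀ j (unique _ z))
      ... | no _ = refl

    σ : K → Fin size → Fin size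
    σ y i = idx (y * enum i)

    σ-inverse : ∀ y (nz : ¬ (y ≈ 0#)) i → σ (inv y nz) (σ y i) ≡ i
    σ-inverse y nz i = P.trans (idx-cong e) (idx-enum i)
      where
      e : inv y nz * enum (idx (y * enum i)) ≈ enum i
      e = begin
        inv y nz * enum (idx (y * enum i)) ≈⟨ *-congˡ (enum-idx _) ⟩
        inv y nz * (y * enum i) ≈⟨ sym (*-assoc _ _ _) ⟩
        (inv y nz * y) * enum i ≈⟨ *-congʳ (trans (*-comm _ _) (inv-r y nz)) ⟩
        1# * enum i ≈⟨ *-identityˡ _ ⟩
        enum i ∎

    inv-nz : ¬ (inv x x≠0 ≈ 0#)
    inv-nz z = 0≉1 (trans (sym (zeroʳ x)) (trans (*-congˡ (sym z)) (inv-r x x≠0)))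

    σ-inverse′ : ∀ i → σ x (σ (inv x x≠0) i) ≡ i
    σ-inverse′ i = P.trans (idx-cong (*-congʳ inv-inv)) (σ-inverse (inv x x≠0) inv-nz i)
      where
      inv-inv : x ≈ inv (inv x x≠0) inv-nz
      inv-inv = cancelˡ (inv x x≠0) inv-nz
        (trans (trans (*-comm _ _) (inv-r x x≠0)) (sym (inv-r _ inv-nz)))

    fermat-nz : pw x size ≈ x
    fermat-nz = sym (cancelˡ U (product-nz _ (λ i → u-nz (enum i))) eq)
      where
      π : Perm.Permutation size size
      π = Perm.permutation (σ x) (σ (inv x x≠0)) σ-inverse′ (σ-inverse x x≠0)
      U : K
      U = product (λ i → u (enum i))
      permuted : U ≈ product (λ i → u (x * enum i))
      permuted = trans (sum-permute (λ i → u (enum i)) π) (sum-cong-≋ (λ i → u-cong (enum-idx (x * enum i))))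
      one-zero : ∀ j → enum j ≈ 0# → j ≡ idx 0#
      one-zero j z = P.trans (P.sym (idx-enum j)) (idx-cong z)
      eq : U * x ≈ U * pw x size
      eq = begin
        U * x ≈⟨ *-cong permuted (sym (product-k enum (idx 0#) (enum-idx 0#) one-zero)) ⟩
        product (λ i → u (x * enum i)) * product (λ i → k (enum i)) ≈⟨ sym (∑-distrib-+ (λ i → u (x * enum i)) (λ i → k (enum i))) ⟩
        product (λ i → u (x * enum i) * k (enum i)) ≈⟨ sum-cong-≋ (λ i → u-scale (enum i)) ⟩
        product (λ i → x * u (enum i)) ≈⟨ product-scale x (λ i → u (enum i)) ⟩
        pw x size * U ≈⟨ *-comm _ _ ⟩
        U * pw x size ∎

  fermat : ∀ x → 1 ≤ size → pw x size ≈ x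
  fermat x h with x ≟ 0#
  ... | no nz = fermat-nz x nz
  fermat x (s≤s h) | yes z = trans (*-cong z refl) (trans (zeroˡ _) (sym z))

module Evaluation {c ℓ : Level} (F : FiniteField c ℓ) where
  open import Data.Nat using (zero; suc; _≤_; _<_)
  open import Data.Fin using (Fin; inject≤) renaming (zero to fz; suc to fs)
  open import Data.Fin.Properties using (inject≤-injective)
  open import Data.List using (List; []; _∷_; length)
  open import Data.Product using (_,_)
  open import Data.Sum using (inj₁; inj₂)
  open import Relation.Nullary using (¬_; yes; no)
  open import Data.Empty using (⊥-elim)
  open import Relation.Binary.PropositionalEquality as P using (_≡_)
  import Relation.Binary.Reasoning.Setoid as SR
  open FiniteField F renaming (Carrier to K) hiding (zero)
  open Poly F
  open PolyRing F
  open FieldFacts F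
  open RootBound cring public using (eval; lastCoeff; too-many-roots)
  open SR setoid

  eval-zero : ∀ {p} x → p ≋ [] → eval p x ≈ 0#
  eval-zero {[]} x e = refl
  eval-zero {a ∷ p} x e = trans (+-cong (zero-head e) (trans (*-congˡ (eval-zero x (zero-tail e))) (zeroʳ x))) (+-identityʳ 0#)

  eval-cong : ∀ {p r} x → p ≋ r → eval p x ≈ eval r x
  eval-cong {[]} x e = sym (eval-zero x (≈ₚ-sym e))
  eval-cong {a ∷ p} {[]} x e = eval-zero x e
  eval-cong {a ∷ p} {b ∷ r} x e = +-cong (get e zero) (*-congˡ (eval-cong {p} {r} x (mk λ n → get e (suc n))))

  eval-+ : ∀ p r x → eval (p +ₚ r) x ≈ eval p x + eval r x
  eval-+ [] r x = sym (+-identityˡ _)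
  eval-+ (a ∷ p) [] x = sym (+-identityʳ _)
  eval-+ (a ∷ p) (b ∷ r) x = begin
    (a + b) + x * eval (p +ₚ r) x ≈⟨ +-congˡ (*-congˡ (eval-+ p r x)) ⟩
    (a + b) + x * (eval p x + eval r x) ≈⟨ +-congˡ (distribˡ _ _ _) ⟩
    (a + b) + (x * eval p x + x * eval r x) ≈⟨ +-assoc _ _ _ ⟩
    a + (b + (x * eval p x + x * eval r x)) ≈⟨ +-congˡ (trans (sym (+-assoc _ _ _)) (trans (+-congʳ (+-comm _ _)) (+-assoc _ _ _))) ⟩
    a + (x * eval p x + (b + x * eval r x)) ≈⟨ sym (+-assoc _ _ _) ⟩
    (a + x * eval p x) + (b + x * eval r x) ∎

  eval-· : ∀ a p x → eval (a ·ₚ p) x ≈ a * eval p x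
  eval-· a [] x = sym (zeroʳ a)
  eval-· a (b ∷ p) x = begin
    a * b + x * eval (a ·ₚ p) x ≈⟨ +-congˡ (*-congˡ (eval-· a p x)) ⟩
    a * b + x * (a * eval p x) ≈⟨ +-congˡ (trans (sym (*-assoc _ _ _)) (trans (*-congʳ (*-comm _ _)) (*-assoc _ _ _))) ⟩
    a * b + a * (x * eval p x) ≈⟨ sym (distribˡ _ _ _) ⟩
    a * (b + x * eval p x) ∎

  eval-neg : ∀ p x → eval (-ₚ p) x ≈ - eval p x
  eval-neg [] x = sym -0#≈0#
  eval-neg (a ∷ p) x = begin
    - a + x * eval (-ₚ p) x ≈⟨ +-congˡ (*-congˡ (eval-neg p x)) ⟩
    - a + x * (- eval p x) ≈⟨ +-congˡ (sym (-‿distribʳ-* _ _)) ⟩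
    - a + - (x * eval p x) ≈⟨ -‿+-comm _ _ ⟩
    - (a + x * eval p x) ∎
    where
    open import Algebra.Properties.Ring ring using (-‿distribʳ-*)
    open import Algebra.Properties.AbelianGroup +-abelianGroup using () renaming (⁻¹-∙-comm to -‿+-comm)

  eval-* : ∀ p r x → eval (p *ₚ r) x ≈ eval p x * eval r x
  eval-* [] r x = sym (zeroˡ _)
  eval-* (a ∷ p) r x = begin
    eval ((a ·ₚ r) +ₚ (0# ∷ (p *ₚ r))) x ≈⟨ eval-+ (a ·ₚ r) (0# ∷ (p *ₚ r)) x ⟩
    eval (a ·ₚ r) x + (0# + x * eval (p *ₚ r) x) ≈⟨ +-cong (eval-· a r x) (trans (+-identityˡ _) (*-congˡ (eval-* p r x))) ⟩
    a * eval r x + x * (eval p x * eval r x) ≈⟨ +-congˡ (sym (*-assoc _ _ _)) ⟩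
    a * eval r x + (x * eval p x) * eval r x ≈⟨ sym (distribʳ _ _ _) ⟩
    (a + x * eval p x) * eval r x ∎

  eval-pow : ∀ p n x → eval (p ^ₚ n) x ≈ pw (eval p x) n
  eval-pow p zero x = trans (+-congˡ (zeroʳ x)) (+-identityʳ 1#)
  eval-pow p (suc n) x = trans (eval-* p (p ^ₚ n) x) (*-congˡ (eval-pow p n x))

  data Norm (p : A) : Set (c Level.⊔ ℓ) where
    isZero : p ≋ [] → Norm p
    isNZ : ∀ m (h : List K) → length h ≡ suc m → ¬ (lastCoeff h ≈ 0#) → h ≋ p → Norm p

  norm : ∀ p → Norm p
  norm [] = isZero ≈ₚ-refl
  norm (a ∷ p) with norm p
  ... | isNZ m (b ∷ h) len nz e = isNZ (suc m) (a ∷ b ∷ h) (P.cong suc len) nz (∷-cong refl e)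
  ... | isZero e with a ≟ 0#
  ...   | yes z = isZero (≈ₚ-trans (∷-cong z e) 0∷-[])
  ...   | no nz = isNZ zero (a ∷ []) P.refl nz (∷-cong refl (≈ₚ-sym e))

  coeff-last : ∀ m (h : List K) → length h ≡ suc m → coeff h m ≈ lastCoeff h
  coeff-last zero (a ∷ []) P.refl = refl
  coeff-last (suc m) (a ∷ b ∷ h) len = coeff-last m (b ∷ h) (P.cong Data.Nat.pred len)

  lastCoeff-· : ∀ a (h : List K) → lastCoeff (a ·ₚ h) ≈ a * lastCoeff h
  lastCoeff-· a [] = sym (zeroʳ a)
  lastCoeff-· a (b ∷ []) = refl
  lastCoeff-· a (b ∷ b' ∷ h) = lastCoeff-· a (b' ∷ h)

  length-· : ∀ a (h : List K) → length (a ·ₚ h) ≡ length h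
  length-· a [] = P.refl
  length-· a (b ∷ h) = P.cong suc (length-· a h)

  no-zero-divisors : ∀ x y → ¬ (x ≈ 0#) → x * y ≈ 0# → y ≈ 0#
  no-zero-divisors x y nz e = cancelˡ x nz (trans e (sym (zeroʳ x)))

  vanishes-identically : ∀ n (g : A) → (∀ k → n ≤ k → coeff g k ≈ 0#) →
             (r : Fin n → K) → (∀ i j → r i ≈ r j → i ≡ j) →
             (∀ i → eval g (r i) ≈ 0#) → g ≋ []
  vanishes-identically n g hi r inj z with norm g
  ... | isZero e = e
  ... | isNZ m h len nz e = ⊥-elim (too-many-roots (λ e → 0≉1 (sym e)) no-zero-divisors m h' len' l' r' inj' z')
    where
    iv = inv (lastCoeff h) nz
    h' = iv ·ₚ h
    len' : length h' ≡ suc m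
    len' = P.trans (length-· iv h) len
    l' : lastCoeff h' ≈ 1#
    l' = trans (lastCoeff-· iv h) (trans (*-comm _ _) (inv-r _ nz))
    m<n : suc m ≤ n
    m<n with Data.Nat.Properties.≤-<-connex n m
    ... | inj₂ lt = lt
    ... | inj₁ n≤m = ⊥-elim (nz (trans (sym (coeff-last m h len)) (trans (get e m) (hi m n≤m))))
    r' : Fin (suc m) → K
    r' i = r (inject≤ i m<n)
    inj' : ∀ i j → r' i ≈ r' j → i ≡ j
    inj' i j q = inject≤-injective m<n m<n i j (inj _ _ q)
    z' : ∀ i → eval h' (r' i) ≈ 0#
    z' i = trans (eval-· iv h (r' i)) (trans (*-congˡ (trans (eval-cong (r' i) e) (z _))) (zeroʳ _))

-- The
-- polynomial Δ = (1 + T)^q − (1 + T^q) has no coefficients at index ≥ q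
-- and, by Fermat, vanishes at all q points of F; hence Δ = 0, and its k-th
-- coefficient is the image of C(q, k) in F.  (No characteristic is needed.)
module BinomialVanishing {c ℓ : Level} (F : FiniteField c ℓ) (q≥1 : 1 ≤ FiniteField.size F) where
  open import Data.Nat using (ℕ; zero; suc; _≤_; _<_; z≤n; s≤s) renaming (_+_ to _+ℕ_)
  open import Data.Nat.Properties using (<-irrefl; ≤-<-connex)
  open import Data.Nat.Combinatorics using (_C_; k>n⇒nCk≡0; nCk+nC[k+1]≡[n+1]C[k+1]; nCn≡1)
  open import Data.List using ([]; _∷_)
  open import Data.Sum using (inj₁; inj₂)
  open import Relation.Nullary using (¬_; no)
  open import Data.Empty using (⊥-elim)
  open import Relation.Binary.PropositionalEquality as P using (_≡_)
  import Relation.Binary.Reasoning.Setoid as SR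
  open FiniteField F renaming (Carrier to K) hiding (zero)
  open Poly F
  open PolyRing F
  open FieldFacts F
  open Evaluation F
  open SR setoid
  open import Algebra.Properties.AbelianGroup +-abelianGroup using (x≈y⇒x∙y⁻¹≈ε)

  nat : ℕ → K
  nat zero = 0#
  nat (suc n) = 1# + nat n

  nat-+ : ∀ m n → nat (m +ℕ n) ≈ nat m + nat n
  nat-+ zero n = sym (+-identityˡ _)
  nat-+ (suc m) n = trans (+-congˡ (nat-+ m n)) (sym (+-assoc _ _ _))

  natEq : ∀ {m n} → m ≡ n → nat m ≈ nat n
  natEq P.refl = refl

  onePlusT : A
  onePlusT = 1ₚ +ₚ Tₚ

  coeff-1T* : ∀ r k → coeff (onePlusT *ₚ r) (suc k) ≈ coeff r (suc k) + coeff r k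
  coeff-1T* r k = begin
    coeff (((1# + 0#) ·ₚ r) +ₚ (0# ∷ ((1# ·ₚ r) +ₚ (0# ∷ [])))) (suc k)
      ≈⟨ coeff-+ ((1# + 0#) ·ₚ r) (0# ∷ ((1# ·ₚ r) +ₚ (0# ∷ []))) (suc k) ⟩
    coeff ((1# + 0#) ·ₚ r) (suc k) + coeff ((1# ·ₚ r) +ₚ (0# ∷ [])) k
      ≈⟨ +-cong (trans (coeff-· _ r (suc k)) (trans (*-congʳ (+-identityʳ 1#)) (*-identityˡ _)))
                (trans (coeff-+ (1# ·ₚ r) (0# ∷ []) k) (trans (+-cong (trans (coeff-· 1# r k) (*-identityˡ _)) (get 0∷-[] k)) (+-identityʳ _))) ⟩
    coeff r (suc k) + coeff r k ∎

  coeff-1T*0 : ∀ r → coeff (onePlusT *ₚ r) zero ≈ coeff r zero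
  coeff-1T*0 r = begin
    coeff (((1# + 0#) ·ₚ r) +ₚ (0# ∷ ((1# ·ₚ r) +ₚ (0# ∷ [])))) zero
      ≈⟨ coeff-+ ((1# + 0#) ·ₚ r) (0# ∷ ((1# ·ₚ r) +ₚ (0# ∷ []))) zero ⟩
    coeff ((1# + 0#) ·ₚ r) zero + 0# ≈⟨ +-identityʳ _ ⟩
    coeff ((1# + 0#) ·ₚ r) zero ≈⟨ trans (coeff-· _ r zero) (trans (*-congʳ (+-identityʳ 1#)) (*-identityˡ _)) ⟩
    coeff r zero ∎

  coeff-binomial : ∀ n k → coeff (onePlusT ^ₚ n) k ≈ nat (n C k)
  coeff-binomial zero zero = sym (+-identityʳ 1#)
  coeff-binomial zero (suc k) = sym (natEq (k>n⇒nCk≡0 {0} {suc k} (s≤s z≤n)))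
  coeff-binomial (suc n) zero = trans (coeff-1T*0 (onePlusT ^ₚ n)) (coeff-binomial n zero)
  coeff-binomial (suc n) (suc k) = begin
    coeff (onePlusT *ₚ (onePlusT ^ₚ n)) (suc k) ≈⟨ coeff-1T* (onePlusT ^ₚ n) k ⟩
    coeff (onePlusT ^ₚ n) (suc k) + coeff (onePlusT ^ₚ n) k ≈⟨ +-cong (coeff-binomial n (suc k)) (coeff-binomial n k) ⟩
    nat (n C suc k) + nat (n C k) ≈⟨ +-comm _ _ ⟩
    nat (n C k) + nat (n C suc k) ≈⟨ sym (nat-+ (n C k) (n C suc k)) ⟩
    nat (n C k +ℕ n C suc k) ≈⟨ natEq (nCk+nC[k+1]≡[n+1]C[k+1] n k) ⟩
    nat (suc n C suc k) ∎

  coeffT-n : ∀ n → coeff (Tₚ ^ₚ n) n ≈ 1#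
  coeffT-n zero = refl
  coeffT-n (suc n) = trans (get (T*-shift (Tₚ ^ₚ n)) (suc n)) (coeffT-n n)

  coeffT-k : ∀ n k → ¬ (k ≡ n) → coeff (Tₚ ^ₚ n) k ≈ 0#
  coeffT-k zero zero ne = ⊥-elim (ne P.refl)
  coeffT-k zero (suc k) ne = refl
  coeffT-k (suc n) zero ne = get (T*-shift (Tₚ ^ₚ n)) zero
  coeffT-k (suc n) (suc k) ne = trans (get (T*-shift (Tₚ ^ₚ n)) (suc k)) (coeffT-k n k (λ e → ne (P.cong suc e)))

  Δ : A
  Δ = (onePlusT ^ₚ size) -ₚ (1ₚ +ₚ (Tₚ ^ₚ size))

  coeffΔ : ∀ k → coeff Δ k ≈ nat (size C k) - (coeff 1ₚ k + coeff (Tₚ ^ₚ size) k)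
  coeffΔ k = trans (coeff-+ (onePlusT ^ₚ size) _ k)
    (+-cong (coeff-binomial size k) (trans (coeff-neg (1ₚ +ₚ (Tₚ ^ₚ size)) k) (-‿cong (coeff-+ 1ₚ (Tₚ ^ₚ size) k))))

  Δ-high : ∀ k → size ≤ k → coeff Δ k ≈ 0#
  Δ-high k q≤k with ≤-<-connex k size
  Δ-high k q≤k | inj₁ k≤q with Data.Nat.Properties.≤-antisym k≤q q≤k
  Δ-high k q≤k | inj₁ k≤q | P.refl = trans (coeffΔ size) (x≈y⇒x∙y⁻¹≈ε (trans (natEq (nCn≡1 size))
       (trans (+-identityʳ 1#) (sym (trans (+-cong (c1 size q≥1) (coeffT-n size)) (+-identityˡ 1#))))))
    where
    c1 : ∀ n → 1 ≤ n → coeff 1ₚ n ≈ 0#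
    c1 (suc n) _ = refl
  Δ-high k q≤k | inj₂ q<k = trans (coeffΔ k) (x≈y⇒x∙y⁻¹≈ε (trans (natEq (k>n⇒nCk≡0 q<k))
       (sym (trans (+-cong (c1 k q<k) (coeffT-k size k (λ e → <-irrefl (P.sym e) q<k))) (+-identityˡ 0#)))))
    where
    c1 : ∀ n → suc size ≤ n → coeff 1ₚ n ≈ 0#
    c1 (suc n) _ = refl

  eval-1T : ∀ x → eval onePlusT x ≈ 1# + x
  eval-1T x = +-cong (+-identityʳ 1#) (trans (*-congˡ (trans (+-congˡ (zeroʳ x)) (+-identityʳ 1#))) (*-identityʳ x))

  -- ... and every x ∈ F is a root, as (1 + x)^q = 1 + x = 1 + x^q by Fermat
  Δ-root : ∀ x → eval Δ x ≈ 0#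
  Δ-root x = begin
    eval Δ x ≈⟨ eval-+ (onePlusT ^ₚ size) _ x ⟩
    eval (onePlusT ^ₚ size) x + eval (-ₚ (1ₚ +ₚ (Tₚ ^ₚ size))) x ≈⟨ +-cong (eval-pow onePlusT size x) (trans (eval-neg (1ₚ +ₚ (Tₚ ^ₚ size)) x) (-‿cong (eval-+ 1ₚ (Tₚ ^ₚ size) x))) ⟩
    pw (eval onePlusT x) size - (eval 1ₚ x + eval (Tₚ ^ₚ size) x) ≈⟨ x≈y⇒x∙y⁻¹≈ε (trans (fermat _ q≥1) (trans (eval-1T x) (sym (+-cong e1 (trans (eval-pow Tₚ size x) (trans (pwcong eT size) (fermat x q≥1))))))) ⟩
    0# ∎
    where
    e1 : eval 1ₚ x ≈ 1#
    e1 = trans (+-congˡ (zeroʳ x)) (+-identityʳ 1#)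
    eT : eval Tₚ x ≈ x
    eT = trans (+-identityˡ _) (trans (*-congˡ (trans (+-congˡ (zeroʳ x)) (+-identityʳ 1#))) (*-identityʳ x))
    pwcong : ∀ {a b} → a ≈ b → ∀ n → pw a n ≈ pw b n
    pwcong e zero = refl
    pwcong e (suc n) = *-cong e (pwcong e n)

  Δ≈0 : Δ ≋ []
  Δ≈0 = vanishes-identically size Δ Δ-high enum enum-inj (λ i → Δ-root (enum i))

  binomial-vanishes : ∀ k → 0 < k → k < size → nat (size C k) ≈ 0#
  binomial-vanishes (suc k) _ k<q = begin
    nat (size C suc k) ≈⟨ sym (+-identityʳ _) ⟩
    nat (size C suc k) + 0# ≈⟨ +-congˡ (sym (-‿inverseˡ S)) ⟩
    nat (size C suc k) + (- S + S) ≈⟨ sym (+-assoc _ _ _) ⟩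
    (nat (size C suc k) - S) + S ≈⟨ +-cong (trans (sym (coeffΔ (suc k))) (get Δ≈0 (suc k))) (trans (+-identityˡ _) (coeffT-k size (suc k) (λ e → <-irrefl e k<q))) ⟩
    0# + 0# ≈⟨ +-identityˡ 0# ⟩
    0# ∎
    where
    S = coeff 1ₚ (suc k) + coeff (Tₚ ^ₚ size) (suc k)

-- The Frobenius map frob x = x^q is a ring endomorphism of A fixing the
-- constants: it is multiplicative since A is commutative, additive by the
-- binomial theorem and the vanishing of C(q, k) for 0 < k < q, and it fixes
-- constants by Fermat.  frobⁿ j denotes its j-th iterate.
module Frobenius {c ℓ : Level} (F : FiniteField c ℓ) (q≥1 : 1 ≤ FiniteField.size F) where
  open import Data.Nat using (ℕ; zero; suc; _≤_; _<_; z≤n; s≤s; _∸_; _^_) renaming (_*_ to _*ℕ_)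
  open import Data.Nat.Combinatorics using (_C_; nCn≡1)
  open import Data.Fin using (Fin; toℕ; fromℕ; inject₁) renaming (zero to fz; suc to fs)
  open import Data.Fin.Properties using (toℕ-fromℕ; toℕ-inject₁; toℕ<n)
  open import Data.List using ([]; _∷_)
  open import Relation.Binary.PropositionalEquality as P using (_≡_)
  import Relation.Binary.Reasoning.Setoid as SR
  open FiniteField F renaming (Carrier to K) hiding (zero)
  open Poly F
  open PolyRing F
  open FieldFacts F
  open BinomialVanishing F q≥1
  open import Algebra.Properties.CommutativeSemiring.Binomial AR.commutativeSemiring
    using (theorem; binomialExpansion; binomialTerm; binomial)
  import Algebra.Properties.Semiring.Exp AR.semiring as E
  open import Algebra.Properties.CommutativeSemiring.Exp AR.commutativeSemiring using (^-distrib-*)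
  open import Algebra.Definitions.RawMonoid AR.+-rawMonoid using () renaming (_×_ to _×ᵐ_)
  open import Algebra.Properties.Monoid.Sum AR.+-monoid using (sum)
  module RA = SR AR.setoid

  pow≡ : ∀ x n → x E.^ n ≡ x ^ₚ n
  pow≡ x zero = P.refl
  pow≡ x (suc n) = P.cong (x *ₚ_) (pow≡ x n)

  ×-nat : ∀ n x → (n ×ᵐ x) ≋ (nat n ·ₚ x)
  ×-nat zero x = ≈ₚ-sym (·-zero x)
  ×-nat (suc n) x = ≈ₚ-trans (+ₚ-cong (≈ₚ-sym (·-one x)) (×-nat n x)) (≈ₚ-sym (·-distribʳ 1# (nat n) x))

  sum-ends : ∀ m (s : Fin (suc m) → A) → (∀ (i : Fin m) → s (inject₁ i) ≋ []) → sum s ≋ s (fromℕ m)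
  sum-ends zero s z = +ₚ-identityʳ (s fz)
  sum-ends (suc m) s z = ≈ₚ-trans (+ₚ-cong (z fz) (sum-ends m (λ i → s (fs i)) (λ i → z (fs i)))) (+ₚ-identityˡ _)

  frob : A → A
  frob x = x ^ₚ size

  m₀ : ℕ
  m₀ = Data.Nat.pred size
  e₀ : suc m₀ ≡ size
  e₀ = suc-pred q≥1
    where
    suc-pred : ∀ {n} → 1 ≤ n → suc (Data.Nat.pred n) ≡ n
    suc-pred (s≤s _) = P.refl

  -- additivity: the binomial expansion of (x + y)^q keeps only its two end terms
  frob-+ : ∀ x y → frob (x +ₚ y) ≋ (frob x +ₚ frob y)
  frob-+ x y = P.subst (λ n → ((x +ₚ y) ^ₚ n) ≋ ((x ^ₚ n) +ₚ (y ^ₚ n))) e₀ expansion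
    where
    open RA
    m = m₀
    binomial-0 : ∀ k → 0 < k → k < suc m → nat (suc m C k) ≈ 0#
    binomial-0 k p1 p2 = trans (natEq (P.cong (_C k) e₀)) (binomial-vanishes k p1 (P.subst (k <_) e₀ p2))
    t : Fin (suc (suc m)) → A
    t = binomialTerm x y (suc m)
    middle-terms : ∀ (i : Fin m) → t (fs (inject₁ i)) ≋ []
    middle-terms i = ≈ₚ-trans (×-nat (suc m C toℕ (fs (inject₁ i))) (binomial x y (suc m) (fs (inject₁ i)))) (≈ₚ-trans (·ₚ-cong (binomial-0 (suc (toℕ (inject₁ i))) (s≤s z≤n)
                (P.subst (λ z → suc z < suc m) (P.sym (toℕ-inject₁ i)) (s≤s (toℕ<n i)))) ≈ₚ-refl) (·-zero (binomial x y (suc m) (fs (inject₁ i)))))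
    last-term : t (fs (fromℕ m)) ≋ (x ^ₚ suc m)
    last-term = begin
      ((suc m C toℕ (fs (fromℕ m))) ×ᵐ ((x E.^ toℕ (fs (fromℕ m))) *ₚ (y E.^ (suc m ∸ toℕ (fs (fromℕ m))))))
        ≡⟨ P.cong (λ k → (suc m C k) ×ᵐ ((x E.^ k) *ₚ (y E.^ (suc m ∸ k)))) (P.cong suc (toℕ-fromℕ m)) ⟩
      ((suc m C suc m) ×ᵐ ((x E.^ suc m) *ₚ (y E.^ (suc m ∸ suc m))))
        ≡⟨ P.cong (λ k → k ×ᵐ ((x E.^ suc m) *ₚ (y E.^ (suc m ∸ suc m)))) (nCn≡1 (suc m)) ⟩
      (1 ×ᵐ ((x E.^ suc m) *ₚ (y E.^ (suc m ∸ suc m))))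
        ≈⟨ +ₚ-identityʳ _ ⟩
      ((x E.^ suc m) *ₚ (y E.^ (suc m ∸ suc m)))
        ≡⟨ P.cong (λ k → (x E.^ suc m) *ₚ (y E.^ k)) (Data.Nat.Properties.n∸n≡0 m) ⟩
      ((x E.^ suc m) *ₚ 1ₚ)
        ≈⟨ AR.*-identityʳ _ ⟩
      (x E.^ suc m) ≡⟨ pow≡ x (suc m) ⟩
      (x ^ₚ suc m) ∎
    first-term : t fz ≋ (y ^ₚ suc m)
    first-term = begin
      (1 ×ᵐ (1ₚ *ₚ (y E.^ suc m))) ≈⟨ +ₚ-identityʳ _ ⟩
      (1ₚ *ₚ (y E.^ suc m)) ≈⟨ AR.*-identityˡ _ ⟩
      (y E.^ suc m) ≡⟨ pow≡ y (suc m) ⟩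
      (y ^ₚ suc m) ∎
    expansion : ((x +ₚ y) ^ₚ suc m) ≋ ((x ^ₚ suc m) +ₚ (y ^ₚ suc m))
    expansion = begin
      ((x +ₚ y) ^ₚ suc m) ≡⟨ P.sym (pow≡ (x +ₚ y) (suc m)) ⟩
      ((x +ₚ y) E.^ suc m) ≈⟨ theorem (suc m) x y ⟩
      (t fz +ₚ sum (λ i → t (fs i))) ≈⟨ +ₚ-cong first-term (≈ₚ-trans (sum-ends m (λ i → t (fs i)) middle-terms) last-term) ⟩
      ((y ^ₚ suc m) +ₚ (x ^ₚ suc m)) ≈⟨ +ₚ-comm (y ^ₚ suc m) (x ^ₚ suc m) ⟩
      ((x ^ₚ suc m) +ₚ (y ^ₚ suc m)) ∎

  frob-* : ∀ x y → frob (x *ₚ y) ≋ (frob x *ₚ frob y)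
  frob-* x y = P.subst₂ (λ a b → a ≋ b) (pow≡ (x *ₚ y) size) (P.cong₂ _*ₚ_ (pow≡ x size) (pow≡ y size)) (^-distrib-* x y size)

  pow-cong : ∀ {x y} n → x ≋ y → (x ^ₚ n) ≋ (y ^ₚ n)
  pow-cong zero e = ≈ₚ-refl
  pow-cong (suc n) e = *ₚ-cong e (pow-cong n e)

  frob-cong : ∀ {x y} → x ≋ y → frob x ≋ frob y
  frob-cong = pow-cong size

  const-pow : ∀ a n → ((a ∷ []) ^ₚ n) ≋ (pw a n ∷ [])
  const-pow a zero = ≈ₚ-refl
  const-pow a (suc n) = ≈ₚ-trans (*ₚ-cong {a ∷ []} ≈ₚ-refl (const-pow a n))
    (≈ₚ-trans (+ₚ-cong {a ·ₚ (pw a n ∷ [])} ≈ₚ-refl 0∷-[]) (+ₚ-identityʳ (a ·ₚ (pw a n ∷ []))))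

  frob-const : ∀ a → frob (a ∷ []) ≋ (a ∷ [])
  frob-const a = ≈ₚ-trans (const-pow a size) (∷-cong (fermat a q≥1) ≈ₚ-refl)

  frob-0 : frob [] ≋ []
  frob-0 = P.subst (λ n → ([] ^ₚ n) ≋ []) e₀ ≈ₚ-refl

  frob-· : ∀ a x → frob (a ·ₚ x) ≋ (a ·ₚ frob x)
  frob-· a x = AR.trans (frob-cong (·-as-* a x)) (AR.trans (frob-* _ x) (AR.trans (*ₚ-cong (frob-const a) ≈ₚ-refl) (AR.sym (·-as-* a (frob x)))))

  frobⁿ : ℕ → A → A
  frobⁿ zero x = x
  frobⁿ (suc j) x = frob (frobⁿ j x)

  frobⁿ-cong : ∀ j {x y} → x ≋ y → frobⁿ j x ≋ frobⁿ j y
  frobⁿ-cong zero e = e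
  frobⁿ-cong (suc j) e = frob-cong (frobⁿ-cong j e)

  frobⁿ-+ : ∀ j x y → frobⁿ j (x +ₚ y) ≋ (frobⁿ j x +ₚ frobⁿ j y)
  frobⁿ-+ zero x y = ≈ₚ-refl
  frobⁿ-+ (suc j) x y = AR.trans (frob-cong (frobⁿ-+ j x y)) (frob-+ _ _)

  frobⁿ-* : ∀ j x y → frobⁿ j (x *ₚ y) ≋ (frobⁿ j x *ₚ frobⁿ j y)
  frobⁿ-* zero x y = ≈ₚ-refl
  frobⁿ-* (suc j) x y = AR.trans (frob-cong (frobⁿ-* j x y)) (frob-* _ _)

  frobⁿ-const : ∀ j a → frobⁿ j (a ∷ []) ≋ (a ∷ [])
  frobⁿ-const zero a = ≈ₚ-refl
  frobⁿ-const (suc j) a = AR.trans (frob-cong (frobⁿ-const j a)) (frob-const a)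

  frobⁿ-0 : ∀ j → frobⁿ j [] ≋ []
  frobⁿ-0 zero = ≈ₚ-refl
  frobⁿ-0 (suc j) = AR.trans (frob-cong (frobⁿ-0 j)) frob-0

  frobⁿ-pow : ∀ i r → frobⁿ i r ≋ (r ^ₚ (size ^ i))
  frobⁿ-pow zero r = AR.sym (AR.*-identityʳ r)
  frobⁿ-pow (suc i) r = begin
    frob (frobⁿ i r) ≈⟨ frob-cong (frobⁿ-pow i r) ⟩
    ((r ^ₚ m) ^ₚ size) ≡⟨ P.cong (_^ₚ size) (P.sym (pow≡ r m)) ⟩
    ((r E.^ m) ^ₚ size) ≡⟨ P.sym (pow≡ (r E.^ m) size) ⟩
    ((r E.^ m) E.^ size) ≈⟨ E.^-assocʳ r m size ⟩
    (r E.^ (m *ℕ size)) ≡⟨ P.cong (r E.^_) (Data.Nat.Properties.*-comm m size) ⟩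
    (r E.^ (size ^ suc i)) ≡⟨ pow≡ r (size ^ suc i) ⟩
    (r ^ₚ (size ^ suc i)) ∎
    where
    m = size ^ i
    open RA

-- Each is an induction on the coefficient list of the
-- first argument, using that φ_T = T·(-) + frob is additive and F-linear.
module CarlitzLinearity {c ℓ : Level} (F : FiniteField c ℓ) (q≥1 : 1 ≤ FiniteField.size F) where
  open import Data.Nat using (zero; suc)
  open import Data.List using ([]; _∷_)
  import Relation.Binary.Reasoning.Setoid as SR
  open FiniteField F renaming (Carrier to K) hiding (zero)
  open Poly F
  open PolyRing F
  open Frobenius F q≥1
  open SR AR.setoid

  φT-cong : ∀ {x y} → x ≋ y → φT x ≋ φT y
  φT-cong e = +ₚ-cong (*ₚ-cong {Tₚ} ≈ₚ-refl e) (frob-cong e)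

  φ-congʳ : ∀ a {x y} → x ≋ y → φ a x ≋ φ a y
  φ-congʳ [] e = ≈ₚ-refl
  φ-congʳ (a ∷ p) e = +ₚ-cong (·ₚ-cong refl e) (φ-congʳ p (φT-cong e))

  φ-zero : ∀ {a} b → a ≋ [] → φ a b ≋ []
  φ-zero {[]} b e = ≈ₚ-refl
  φ-zero {a ∷ p} b e = AR.trans (+ₚ-cong (AR.trans (·ₚ-cong (zero-head e) ≈ₚ-refl) (·-zero b)) (φ-zero (φT b) (zero-tail e))) (+ₚ-identityˡ [])

  φ-congˡ : ∀ {a a'} b → a ≋ a' → φ a b ≋ φ a' b
  φ-congˡ {[]} b e = AR.sym (φ-zero b (AR.sym e))
  φ-congˡ {a ∷ p} {[]} b e = φ-zero b e
  φ-congˡ {a ∷ p} {a' ∷ p'} b e = +ₚ-cong (·ₚ-cong (get e zero) ≈ₚ-refl) (φ-congˡ {p} {p'} (φT b) (mk λ n → get e (suc n)))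

  φ-+ˡ : ∀ a a' b → φ (a +ₚ a') b ≋ (φ a b +ₚ φ a' b)
  φ-+ˡ [] a' b = ≈ₚ-refl
  φ-+ˡ (a ∷ p) [] b = AR.sym (+ₚ-identityʳ _)
  φ-+ˡ (a ∷ p) (a' ∷ p') b = AR.trans (+ₚ-cong (·-distribʳ a a' b) (φ-+ˡ p p' (φT b)))
    (swap-mid (a ·ₚ b) (a' ·ₚ b) (φ p (φT b)) (φ p' (φT b)))

  φ-·ˡ : ∀ c a b → φ (c ·ₚ a) b ≋ (c ·ₚ φ a b)
  φ-·ˡ c [] b = AR.sym (·-on-zero c ≈ₚ-refl)
  φ-·ˡ c (a ∷ p) b = AR.trans (+ₚ-cong (AR.sym (·-assoc c a b)) (φ-·ˡ c p (φT b))) (AR.sym (·-distribˡ c (a ·ₚ b) (φ p (φT b))))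

  -- φ_T is additive and F-linear, hence commutes with every φ_a
  φT-+ : ∀ x y → φT (x +ₚ y) ≋ (φT x +ₚ φT y)
  φT-+ x y = AR.trans (+ₚ-cong (AR.distribˡ Tₚ x y) (frob-+ x y)) (swap-mid (Tₚ *ₚ x) (Tₚ *ₚ y) (frob x) (frob y))

  φT-· : ∀ c x → φT (c ·ₚ x) ≋ (c ·ₚ φT x)
  φT-· c x = AR.trans (+ₚ-cong (·-*ʳ c Tₚ x) (frob-· c x)) (AR.sym (·-distribˡ c (Tₚ *ₚ x) (frob x)))

  φT-0 : φT [] ≋ []
  φT-0 = AR.trans (+ₚ-cong (AR.zeroʳ Tₚ) frob-0) (+ₚ-identityˡ _)

  φT-comm : ∀ a b → φT (φ a b) ≋ φ a (φT b)
  φT-comm [] b = φT-0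
  φT-comm (a ∷ p) b = AR.trans (φT-+ (a ·ₚ b) (φ p (φT b))) (+ₚ-cong (φT-· a b) (φT-comm p (φT b)))

  φ-0∷ : ∀ p b → φ (0# ∷ p) b ≋ φ p (φT b)
  φ-0∷ p b = AR.trans (+ₚ-cong (·-zero b) ≈ₚ-refl) (+ₚ-identityˡ _)

  φ-* : ∀ f r b → φ (f *ₚ r) b ≋ φ f (φ r b)
  φ-* [] r b = ≈ₚ-refl
  φ-* (a ∷ f) r b = begin
    φ ((a ·ₚ r) +ₚ (0# ∷ (f *ₚ r))) b ≈⟨ φ-+ˡ (a ·ₚ r) (0# ∷ (f *ₚ r)) b ⟩
    (φ (a ·ₚ r) b +ₚ φ (0# ∷ (f *ₚ r)) b) ≈⟨ +ₚ-cong (φ-·ˡ a r b) (φ-0∷ (f *ₚ r) b) ⟩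
    ((a ·ₚ φ r b) +ₚ φ (f *ₚ r) (φT b)) ≈⟨ +ₚ-cong ≈ₚ-refl (φ-* f r (φT b)) ⟩
    ((a ·ₚ φ r b) +ₚ φ f (φ r (φT b))) ≈⟨ +ₚ-cong ≈ₚ-refl (φ-congʳ f (AR.sym (φT-comm r b))) ⟩
    ((a ·ₚ φ r b) +ₚ φ f (φT (φ r b))) ∎

-- A divisor of degree m is given as a vector B of length m + 1 with nonzero
-- last coefficient; remainders are vectors of length m, so that the length
-- of the divisor is an explicit termination measure for Euclid's algorithm.
module Division {c ℓ : Level} (F : FiniteField c ℓ) where
  open import Data.Nat using (zero; suc; _≤_; z≤n; s≤s)
  open import Data.Nat.Properties using (≤-trans)
  open import Data.Vec using (Vec; []; _∷_; toList; replicate; map)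
  import Data.Vec.Properties
  open import Data.List using (length) renaming ([] to []ₗ; _∷_ to _∷ₗ_)
  open import Data.Product using (_×_; _,_; proj₁; proj₂)
  open import Relation.Nullary using (¬_; yes; no)
  open import Relation.Binary.PropositionalEquality as P using (_≡_)
  import Relation.Binary.Reasoning.Setoid as SR
  open FiniteField F renaming (Carrier to K) hiding (zero)
  open Poly F
  open PolyRing F
  open FieldFacts F
  open SR AR.setoid

  toL : ∀ {n} → Vec K n → A
  toL = toList

  initV : ∀ {m} → Vec K (suc m) → Vec K m
  initV {zero} (x ∷ []) = []
  initV {suc m} (x ∷ xs) = x ∷ initV xs

  lastV : ∀ {m} → Vec K (suc m) → K
  lastV {zero} (x ∷ []) = x
  lastV {suc m} (x ∷ xs) = lastV xs

  initV-spec : ∀ {m} (w : Vec K (suc m)) → lastV w ≈ 0# → toL w ≋ toL (initV w)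
  initV-spec {zero} (x ∷ []) z = AR.trans (∷-cong z ≈ₚ-refl) 0∷-[]
  initV-spec {suc m} (x ∷ xs) z = ∷-cong refl (initV-spec xs z)

  subScaled : ∀ {n} → K → Vec K n → Vec K n → Vec K n
  subScaled c0 [] [] = []
  subScaled c0 (x ∷ u) (y ∷ v) = (x - c0 * y) ∷ subScaled c0 u v

  subScaled-spec : ∀ {n} c0 (u v : Vec K n) → toL (subScaled c0 u v) ≋ (toL u +ₚ (-ₚ (c0 ·ₚ toL v)))
  subScaled-spec c0 [] [] = ≈ₚ-refl
  subScaled-spec c0 (x ∷ u) (y ∷ v) = ∷-cong refl (subScaled-spec c0 u v)

  subScaled-last : ∀ {m} c0 (u v : Vec K (suc m)) → lastV (subScaled c0 u v) ≡ (lastV u - c0 * lastV v)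
  subScaled-last {zero} c0 (x ∷ []) (y ∷ []) = P.refl
  subScaled-last {suc m} c0 (x ∷ u) (y ∷ v) = subScaled-last c0 u v

  zeros : ∀ m → toL (replicate m 0#) ≋ []ₗ
  zeros zero = ≈ₚ-refl
  zeros (suc m) = AR.trans (∷-cong refl (zeros m)) 0∷-[]

  -- If p = s·B + r then a + T·p = (c + T·s)·B + (a + T·r − c·B), where c is
  -- the top coefficient of a + T·r; the last remainder is of length m + 1
  -- with vanishing top coefficient, so it is cut down to length m.
  divide : ∀ m (B : Vec K (suc m)) → A → A × Vec K m
  divide m B []ₗ = []ₗ , replicate m 0#
  divide m B (a ∷ₗ p) =
    let (s , r) = divide m B p
        c = lastV (a ∷ r)
    in (c ∷ₗ s) , initV (subScaled c (a ∷ r) B)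

  open import Algebra.Solver.CommutativeMonoid +ₚ-cm as CMS using (_⊕_; _⊜_)

  divide-spec : ∀ m (B : Vec K (suc m)) → lastV B ≈ 1# → ∀ p →
            p ≋ ((proj₁ (divide m B p) *ₚ toL B) +ₚ toL (proj₂ (divide m B p)))
  divide-spec m B l1 []ₗ = AR.sym (zeros m)
  divide-spec m B l1 (a ∷ₗ p) = AR.trans lhs (AR.sym rhs)
    where
    s = proj₁ (divide m B p)
    r = proj₂ (divide m B p)
    c0 = lastV (a ∷ r)
    zs = subScaled c0 (a ∷ r) B
    X = c0 ·ₚ toL B
    Y = 0# ∷ₗ (s *ₚ toL B)
    Z = a ∷ₗ []ₗ
    W = 0# ∷ₗ toL r
    lhs : (a ∷ₗ p) ≋ (Z +ₚ (Y +ₚ W))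
    lhs = begin
      (a ∷ₗ p) ≈⟨ cons-split a p ⟩
      (Z +ₚ (0# ∷ₗ p)) ≈⟨ +ₚ-congˡ Z (0∷-cong (divide-spec m B l1 p)) ⟩
      (Z +ₚ (0# ∷ₗ ((s *ₚ toL B) +ₚ toL r))) ≈⟨ +ₚ-congˡ Z (0∷-+ (s *ₚ toL B) (toL r)) ⟩
      (Z +ₚ (Y +ₚ W)) ∎
    lastzs : lastV zs ≈ 0#
    lastzs = P.subst (λ t → t ≈ 0#) (P.sym (subScaled-last c0 (a ∷ r) B))
               (trans (+-congˡ (-‿cong (trans (*-congˡ l1) (*-identityʳ c0)))) (-‿inverseʳ c0))
    rhs : ((X +ₚ Y) +ₚ toL (initV zs)) ≋ (Z +ₚ (Y +ₚ W))
    rhs = begin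
      ((X +ₚ Y) +ₚ toL (initV zs)) ≈⟨ +ₚ-congˡ (X +ₚ Y) (AR.sym (initV-spec zs lastzs)) ⟩
      ((X +ₚ Y) +ₚ toL zs) ≈⟨ +ₚ-congˡ (X +ₚ Y) (subScaled-spec c0 (a ∷ r) B) ⟩
      ((X +ₚ Y) +ₚ ((a ∷ₗ toL r) +ₚ (-ₚ X))) ≈⟨ +ₚ-congˡ (X +ₚ Y) (+ₚ-congʳ (-ₚ X) (cons-split a (toL r))) ⟩
      ((X +ₚ Y) +ₚ ((Z +ₚ W) +ₚ (-ₚ X))) ≈⟨ CMS.solve 5 (λ x y z w nx → ((x ⊕ y) ⊕ ((z ⊕ w) ⊕ nx)) ⊜ ((z ⊕ (y ⊕ w)) ⊕ (x ⊕ nx))) ≈ₚ-refl X Y Z W (-ₚ X) ⟩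
      ((Z +ₚ (Y +ₚ W)) +ₚ (X +ₚ (-ₚ X))) ≈⟨ +ₚ-congˡ (Z +ₚ (Y +ₚ W)) (-ₚ-inverseʳ X) ⟩
      ((Z +ₚ (Y +ₚ W)) +ₚ []ₗ) ≈⟨ +ₚ-identityʳ _ ⟩
      (Z +ₚ (Y +ₚ W)) ∎

  data NormV (p : A) : Set (c Level.⊔ ℓ) where
    isZ : p ≋ []ₗ → NormV p
    isNZ : ∀ m (v : Vec K (suc m)) → ¬ (lastV v ≈ 0#) → toL v ≋ p → suc m ≤ length p → NormV p

  normV : ∀ p → NormV p
  normV []ₗ = isZ ≈ₚ-refl
  normV (a ∷ₗ p) with normV p
  ... | isNZ m v nz e le = isNZ (suc m) (a ∷ v) nz (∷-cong refl e) (s≤s le)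
  ... | isZ e with a ≟ 0#
  ...   | yes z = isZ (AR.trans (∷-cong z e) 0∷-[])
  ...   | no nz = isNZ zero (a ∷ []) nz (∷-cong refl (AR.sym e)) (s≤s z≤n)

  length-toL : ∀ {m} (v : Vec K m) → length (toL v) ≡ m
  length-toL [] = P.refl
  length-toL (x ∷ v) = P.cong suc (length-toL v)

  lastV-map : ∀ {m} a (v : Vec K (suc m)) → lastV (map (a *_) v) ≡ a * lastV v
  lastV-map {zero} a (x ∷ []) = P.refl
  lastV-map {suc m} a (x ∷ v) = lastV-map a v

  record Bezout (a b : A) : Set (c Level.⊔ ℓ) where
    field
      gcd α β qa qb : A
      gcd-combination : gcd ≋ ((α *ₚ a) +ₚ (β *ₚ b))
      gcd∣a : a ≋ (qa *ₚ gcd)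
      gcd∣b : b ≋ (qb *ₚ gcd)

  open RingIdentities Aring using (euclid-combination; euclid-divisor)

  -- Euclid's algorithm on (a, B), by induction on a bound n for the length of B:
  -- divide a by B (made monic) and recurse on (B, remainder) unless it vanishes.
  extended-euclid : ∀ n a m (B : Vec K (suc m)) → suc m ≤ n → ¬ (lastV B ≈ 0#) → Bezout a (toL B)
  extended-euclid (suc n) a m B (s≤s le) nz = result (normV (toL r))
    where
    ci = inv (lastV B) nz
    B1 = map (ci *_) B
    l1 : lastV B1 ≈ 1#
    l1 = P.subst (λ t → t ≈ 1#) (P.sym (lastV-map ci B)) (trans (*-comm _ _) (inv-r _ nz))
    B1≈ : toL B1 ≋ (ci ·ₚ toL B)
    B1≈ = P.subst (λ t → t ≋ (ci ·ₚ toL B)) (P.sym (Data.Vec.Properties.toList-map (ci *_) B)) ≈ₚ-refl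
    s = proj₁ (divide m B1 a)
    r = proj₂ (divide m B1 a)
    z = ci ·ₚ s
    sB1 : (s *ₚ toL B1) ≋ (z *ₚ toL B)
    sB1 = AR.trans (*ₚ-congˡ s B1≈) (AR.trans (·-*ʳ ci s (toL B)) (AR.sym (·-*ˡ ci s (toL B))))
    a≈ : a ≋ ((z *ₚ toL B) +ₚ toL r)
    a≈ = AR.trans (divide-spec m B1 l1 a) (+ₚ-congʳ (toL r) sB1)
    result : NormV (toL r) → Bezout a (toL B)
    result (isZ e) = record
      { gcd = toL B ; α = []ₗ ; β = 1ₚ ; qa = z ; qb = 1ₚ
      ; gcd-combination = AR.sym (*-identityˡ' (toL B))
      ; gcd∣a = AR.trans a≈ (AR.trans (+ₚ-congˡ (z *ₚ toL B) e) (+ₚ-identityʳ _))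
      ; gcd∣b = AR.sym (*-identityˡ' (toL B)) }
    result (isNZ m' v' nz' e' le') = record
      { gcd = gcd ; α = w ; β = α +ₚ (-ₚ (w *ₚ z)) ; qa = (z *ₚ s') +ₚ t' ; qb = s'
      ; gcd-combination = euclid-combination a z (toL B) (toL v') gcd α w (AR.trans a≈ (+ₚ-congˡ (z *ₚ toL B) (AR.sym e'))) gcd-combination
      ; gcd∣a = euclid-divisor a z (toL B) (toL v') gcd s' t' (AR.trans a≈ (+ₚ-congˡ (z *ₚ toL B) (AR.sym e'))) gcd∣a gcd∣b
      ; gcd∣b = gcd∣a }
      where
      le2 : suc m' ≤ n
      le2 = ≤-trans (P.subst (suc m' ≤_) (length-toL r) le') le
      IH = extended-euclid n (toL B) m' v' le2 nz'
      open Bezout IH renaming (qa to s'; qb to t'; β to w)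

-- A nonzero multiple of
-- P has a nonzero coefficient at index ≥ d (compare leading coefficients),
-- and Euclid's algorithm on (a, P) yields a Bézout relation u·a + w·P = 1
-- whenever P ∤ a, since the gcd divides the irreducible P and is not
-- associate to it.
module IrreducibleDivisor {c ℓ : Level} (F : FiniteField c ℓ) (PP : Poly.A F) (monic : Poly.Monic F PP) (irr : Poly.Irreducible F PP) where
  open import Data.Nat using (ℕ; zero; suc; _≤_; _<_; s≤s) renaming (_+_ to _+ℕ_)
  open import Data.Nat.Properties using (≤-refl; m≤n+m)
  open import Data.Vec using (Vec; []; _∷_)
  open import Data.List using () renaming ([] to []ₗ; _∷_ to _∷ₗ_)
  open import Data.Product using (Σ; _,_; proj₁; proj₂)
  open import Data.Sum using (_⊎_; inj₁; inj₂)
  open import Relation.Nullary using (¬_)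
  open import Data.Empty using (⊥-elim)
  import Relation.Binary.Reasoning.Setoid as SR
  open FiniteField F renaming (Carrier to K) hiding (zero)
  open Poly F
  open PolyRing F
  open FieldFacts F
  open Division F
  open RingIdentities Aring using (solve; _:+_; _:*_; _:=_)

  d : ℕ
  d = proj₁ monic
  lead : coeff PP d ≈ 1#
  lead = proj₁ (proj₂ monic)
  high : ∀ n → d < n → coeff PP n ≈ 0#
  high = proj₂ (proj₂ monic)

  P∤1 : ¬ (PP ∣′ 1ₚ)
  P∤1 (z , e) = Irreducible.p∤1 irr record { quotient = z ; equality = get e }

  top-coeff : ∀ m (v : Vec K (suc m)) → coeff (toL v *ₚ PP) (m +ℕ d) ≈ lastV v * coeff PP d
  top-coeff zero (a ∷ []) = trans (coeff-+ (a ·ₚ PP) (0# ∷ₗ []ₗ) d) (trans (+-congˡ (get 0∷-[] d)) (trans (+-identityʳ _) (coeff-· a PP d)))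
  top-coeff (suc m) (a ∷ v) = begin
    coeff ((a ·ₚ PP) +ₚ (0# ∷ₗ (toL v *ₚ PP))) (suc (m +ℕ d)) ≈⟨ coeff-+ (a ·ₚ PP) (0# ∷ₗ (toL v *ₚ PP)) (suc (m +ℕ d)) ⟩
    coeff (a ·ₚ PP) (suc (m +ℕ d)) + coeff (toL v *ₚ PP) (m +ℕ d) ≈⟨ +-cong (trans (coeff-· a PP _) (trans (*-congˡ (high _ (s≤s (m≤n+m d m)))) (zeroʳ a))) (top-coeff m v) ⟩
    0# + lastV v * coeff PP d ≈⟨ +-identityˡ _ ⟩
    lastV v * coeff PP d ∎
    where open SR setoid

  multiple-below-degree : ∀ f → (∀ k → d ≤ k → coeff f k ≈ 0#) → PP ∣′ f → f ≋ []ₗ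
  multiple-below-degree f hi (z , e) with normV z
  ... | isZ ez = AR.trans (AR.sym e) (*-zeroˡ PP ez)
  ... | isNZ m v nz ev le = ⊥-elim (nz (cancel (trans (sym (top-coeff m v)) (trans (get (*ₚ-congʳ PP ev) _) (trans (get e _) (hi _ (m≤n+m d m)))))))
    where
    cancel : lastV v * coeff PP d ≈ 0# → lastV v ≈ 0#
    cancel h = trans (sym (*-identityʳ _)) (trans (*-congˡ (sym lead)) h)

  bezout : ∀ a → ¬ (PP ∣′ a) → Σ A (λ u → Σ A (λ w → ((u *ₚ a) +ₚ (w *ₚ PP)) ≋ 1ₚ))
  bezout a na with normV PP
  ... | isZ ez = ⊥-elim (0≉1 (trans (sym (get ez d)) lead))
  ... | isNZ m v nz ev le = split (Irreducible.split-∣1 irr (get P≈tg))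
    where
    B = extended-euclid (suc m) a m v ≤-refl nz
    open Bezout B
    P≈tg : PP ≋ (qb *ₚ gcd)
    P≈tg = AR.trans (AR.sym ev) gcd∣b
    split : (qb ∣ 1ₚ) ⊎ (gcd ∣ 1ₚ) → Σ A (λ u → Σ A (λ w → ((u *ₚ a) +ₚ (w *ₚ PP)) ≋ 1ₚ))
    split (inj₁ record { quotient = e ; equality = eqe }) = ⊥-elim (na ((qa *ₚ e) , AR.sym chain))
      where
      open SR AR.setoid
      chain : a ≋ ((qa *ₚ e) *ₚ PP)
      chain = begin
        a ≈⟨ gcd∣a ⟩
        (qa *ₚ gcd) ≈⟨ *ₚ-congˡ qa (AR.sym (AR.*-identityˡ gcd)) ⟩
        (qa *ₚ (1ₚ *ₚ gcd)) ≈⟨ *ₚ-congˡ qa (*ₚ-congʳ {1ₚ} {e *ₚ qb} gcd (AR.sym (mk eqe))) ⟩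
        (qa *ₚ ((e *ₚ qb) *ₚ gcd)) ≈⟨ *ₚ-congˡ qa (AR.*-assoc e qb gcd) ⟩
        (qa *ₚ (e *ₚ (qb *ₚ gcd))) ≈⟨ *ₚ-congˡ qa (*ₚ-congˡ e (AR.sym P≈tg)) ⟩
        (qa *ₚ (e *ₚ PP)) ≈⟨ AR.sym (AR.*-assoc qa e PP) ⟩
        ((qa *ₚ e) *ₚ PP) ∎
    split (inj₂ record { quotient = e ; equality = eqe }) = (e *ₚ α) , (e *ₚ β) , chain
      where
      open SR AR.setoid
      chain : (((e *ₚ α) *ₚ a) +ₚ ((e *ₚ β) *ₚ PP)) ≋ 1ₚ
      chain = begin
        (((e *ₚ α) *ₚ a) +ₚ ((e *ₚ β) *ₚ PP)) ≈⟨ +ₚ-congˡ ((e *ₚ α) *ₚ a) (*ₚ-congˡ (e *ₚ β) (AR.sym ev)) ⟩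
        (((e *ₚ α) *ₚ a) +ₚ ((e *ₚ β) *ₚ toL v)) ≈⟨ solve 5 (λ e u a w V → (((e :* u) :* a) :+ ((e :* w) :* V)) := (e :* ((u :* a) :+ (w :* V)))) ≈ₚ-refl e α a β (toL v) ⟩
        (e *ₚ ((α *ₚ a) +ₚ (β *ₚ toL v))) ≈⟨ *ₚ-congˡ e (AR.sym gcd-combination) ⟩
        (e *ₚ gcd) ≈⟨ mk eqe ⟩
        1ₚ ∎

module CongruenceModP {c ℓ : Level} (F : FiniteField c ℓ) (PP : Poly.A F) (monic : Poly.Monic F PP) (irr : Poly.Irreducible F PP) where
  open import Algebra.Bundles using (CommutativeRing)
  open import Data.List using ([])
  open import Data.Product using (_,_)
  open import Relation.Nullary using (¬_)
  import Relation.Binary.Reasoning.Setoid as SR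
  open FiniteField F renaming (Carrier to K) hiding (zero)
  open Poly F
  open PolyRing F
  open IrreducibleDivisor F PP monic irr

  open Multiples PP public

  prime : ∀ {x y} → ¬ (PP ∣′ x) → PP ∣′ (x *ₚ y) → PP ∣′ y
  prime {x} {y} nx h with bezout x nx
  ... | u , w , e = dv-cong eq (dv-+ (dv-* u h) (dv-* (w *ₚ y) (dv-self 1ₚ)))
    where
    open SR AR.setoid
    eq : ((u *ₚ (x *ₚ y)) +ₚ ((w *ₚ y) *ₚ (1ₚ *ₚ PP))) ≋ y
    eq = begin
      ((u *ₚ (x *ₚ y)) +ₚ ((w *ₚ y) *ₚ (1ₚ *ₚ PP))) ≈⟨ +ₚ-congˡ (u *ₚ (x *ₚ y)) (*ₚ-congˡ (w *ₚ y) (AR.*-identityˡ PP)) ⟩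
      ((u *ₚ (x *ₚ y)) +ₚ ((w *ₚ y) *ₚ PP)) ≈⟨ G.solve 5 (λ u x y w p → ((u G.:* (x G.:* y)) G.:+ ((w G.:* y) G.:* p)) G.:= (((u G.:* x) G.:+ (w G.:* p)) G.:* y)) ≈ₚ-refl u x y w PP ⟩
      (((u *ₚ x) +ₚ (w *ₚ PP)) *ₚ y) ≈⟨ *ₚ-congʳ y e ⟩
      (1ₚ *ₚ y) ≈⟨ AR.*-identityˡ y ⟩
      y ∎

  infix 4 _~_
  record _~_ (x y : A) : Set (c Level.⊔ ℓ) where
    constructor mk~
    field dv : PP ∣′ (x +ₚ (-ₚ y))
  open _~_ public

  ~-refl : ∀ {x} → x ~ x
  ~-refl {x} = mk~ (dv-cong (AR.sym (AR.-‿inverseʳ x)) dv0)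

  ≋⇒~ : ∀ {x y} → x ≋ y → x ~ y
  ≋⇒~ {x} {y} e = mk~ (dv-cong (AR.sym (AR.trans (+ₚ-congʳ (-ₚ y) e) (AR.-‿inverseʳ y))) dv0)

  ~-sym : ∀ {x y} → x ~ y → y ~ x
  ~-sym {x} {y} (mk~ h) = mk~ (dv-cong (G.⁻¹-anti-homo‿- x y) (dv-neg h))

  ~-trans : ∀ {x y z} → x ~ y → y ~ z → x ~ z
  ~-trans {x} {y} {z} (mk~ h) (mk~ h') = mk~ (dv-cong (AR.sym (G.sub-trans x y z)) (dv-+ h h'))

  ~-+ : ∀ {x x' y y'} → x ~ x' → y ~ y' → (x +ₚ y) ~ (x' +ₚ y')
  ~-+ {x} {x'} {y} {y'} (mk~ h) (mk~ h') = mk~ (dv-cong (AR.sym (G.sub-+ x y x' y')) (dv-+ h h'))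

  ~-neg : ∀ {x x'} → x ~ x' → (-ₚ x) ~ (-ₚ x')
  ~-neg {x} {x'} (mk~ h) = mk~ (dv-cong (AR.sym (G.sub-neg x x')) (dv-neg h))

  ~-* : ∀ {x x' y y'} → x ~ x' → y ~ y' → (x *ₚ y) ~ (x' *ₚ y')
  ~-* {x} {x'} {y} {y'} (mk~ h) (mk~ h') = mk~ (dv-cong (AR.sym (G.sub-* x y x' y')) (dv-+ (dv-* x h') (dv-*r y' h)))

  Kring : CommutativeRing c (c Level.⊔ ℓ)
  Kring = record
    { Carrier = A ; _≈_ = _~_ ; _+_ = _+ₚ_ ; _*_ = _*ₚ_ ; -_ = -ₚ_ ; 0# = [] ; 1# = 1ₚ
    ; isCommutativeRing = record
      { isRing = record
        { +-isAbelianGroup = record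
          { isGroup = record
            { isMonoid = record
              { isSemigroup = record
                { isMagma = record
                  { isEquivalence = record { refl = ~-refl ; sym = ~-sym ; trans = ~-trans }
                  ; ∙-cong = ~-+ }
                ; assoc = λ x y z → ≋⇒~ (AR.+-assoc x y z) }
              ; identity = (λ x → ≋⇒~ (AR.+-identityˡ x)) , (λ x → ≋⇒~ (AR.+-identityʳ x)) }
            ; inverse = (λ x → ≋⇒~ (AR.-‿inverseˡ x)) , (λ x → ≋⇒~ (AR.-‿inverseʳ x))
            ; ⁻¹-cong = ~-neg }
          ; comm = λ x y → ≋⇒~ (AR.+-comm x y) }
        ; *-cong = ~-*
        ; *-assoc = λ x y z → ≋⇒~ (AR.*-assoc x y z)
        ; *-identity = (λ x → ≋⇒~ (AR.*-identityˡ x)) , (λ x → ≋⇒~ (AR.*-identityʳ x))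
        ; distrib = (λ x y z → ≋⇒~ (AR.distribˡ x y z)) , (λ x y z → ≋⇒~ (AR.distribʳ x y z)) }
      ; *-comm = λ x y → ≋⇒~ (AR.*-comm x y) } }

  ~0⇒dv : ∀ {x} → x ~ [] → PP ∣′ x
  ~0⇒dv {x} (mk~ h) = dv-cong (+ₚ-identityʳ x) h

  dv⇒~0 : ∀ {x} → PP ∣′ x → x ~ []
  dv⇒~0 {x} h = mk~ (dv-cong (AR.sym (+ₚ-identityʳ x)) h)

  K-1≉0 : ¬ (1ₚ ~ [])
  K-1≉0 e = P∤1 (~0⇒dv e)

  K-dom : ∀ x y → ¬ (x ~ []) → (x *ₚ y) ~ [] → y ~ []
  K-dom x y nx h = dv⇒~0 (prime (λ d → nx (dv⇒~0 d)) (~0⇒dv h))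

-- The Carlitz expansion φ_f(b) = Σ_j c_j(f)·b^(q^j) with coefficients
-- c_j(f) = coeffφ f j ∈ A (computed by Horner's rule from f = a + T·p, since
-- φ_f = a + φ_p ∘ φ_T), together with the facts needed about them: c_0(f) = f,
-- c_d(f) is the leading coefficient and c_j(f) = 0 beyond the degree d, and
-- the commutation φ_T ∘ φ_f = φ_f ∘ φ_T read off coefficientwise:
--     T·c_{j+1} + c_j^q = c_{j+1}·T^(q^(j+1)) + c_j.
module CarlitzExpansion {c ℓ : Level} (F : FiniteField c ℓ) (q≥1 : 1 ≤ FiniteField.size F) where
  open import Data.Nat using (ℕ; zero; suc; _≤_; _<_; z≤n; s≤s)
  import Data.Nat.Properties
  open import Data.List using ([]; _∷_; length)
  open import Data.Product using (_,_)
  open import Relation.Binary.PropositionalEquality as P using (_≡_)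
  import Relation.Binary.Reasoning.Setoid as SR
  open FiniteField F renaming (Carrier to K) hiding (zero)
  open Poly F
  open PolyRing F
  open Frobenius F q≥1
  open CarlitzLinearity F q≥1
  open G using (_:+_; _:*_; _:=_)
  open SR AR.setoid

  -- Tq^ j = T^(q^j)
  Tq^ : ℕ → A
  Tq^ j = frobⁿ j Tₚ

  coeffφ : A → ℕ → A
  coeffφ [] j = []
  coeffφ (a ∷ p) zero = (a ∷ []) +ₚ (coeffφ p zero *ₚ Tₚ)
  coeffφ (a ∷ p) (suc j) = (coeffφ p (suc j) *ₚ Tq^ (suc j)) +ₚ coeffφ p j

  sumTo : ℕ → (ℕ → A) → A
  sumTo zero g = []
  sumTo (suc n) g = g zero +ₚ sumTo n (λ j → g (suc j))

  sumTo-cong : ∀ n {g h} → (∀ j → g j ≋ h j) → sumTo n g ≋ sumTo n h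
  sumTo-cong zero e = ≈ₚ-refl
  sumTo-cong (suc n) e = +ₚ-cong (e zero) (sumTo-cong n (λ j → e (suc j)))

  sumTo-+ : ∀ n g h → sumTo n (λ j → g j +ₚ h j) ≋ (sumTo n g +ₚ sumTo n h)
  sumTo-+ zero g h = AR.sym (+ₚ-identityˡ [])
  sumTo-+ (suc n) g h = AR.trans (+ₚ-congˡ (g zero +ₚ h zero) (sumTo-+ n (λ j → g (suc j)) (λ j → h (suc j))))
    (swap-mid (g zero) (h zero) (sumTo n (λ j → g (suc j))) (sumTo n (λ j → h (suc j))))

  sumTo-shift : ∀ n h → (sumTo n h +ₚ h n) ≋ (h zero +ₚ sumTo n (λ j → h (suc j)))
  sumTo-shift zero h = AR.trans (+ₚ-identityˡ _) (AR.sym (+ₚ-identityʳ _))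
  sumTo-shift (suc n) h = begin
    ((h zero +ₚ sumTo n (λ j → h (suc j))) +ₚ h (suc n)) ≈⟨ AR.+-assoc (h zero) _ _ ⟩
    (h zero +ₚ (sumTo n (λ j → h (suc j)) +ₚ h (suc n))) ≈⟨ +ₚ-congˡ (h zero) (sumTo-shift n (λ j → h (suc j))) ⟩
    (h zero +ₚ (h (suc zero) +ₚ sumTo n (λ j → h (suc (suc j))))) ∎

  vanishing-times : ∀ {x} τ → x ≋ [] → (x *ₚ τ) ≋ []
  vanishing-times τ e = AR.trans (*ₚ-congʳ τ e) (AR.zeroˡ τ)

  both-vanish : ∀ {x y} τ → x ≋ [] → y ≋ [] → ((x *ₚ τ) +ₚ y) ≋ []
  both-vanish τ ex ey = AR.trans (+ₚ-cong (vanishing-times τ ex) ey) (+ₚ-identityˡ [])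

  coeffφ-zero : ∀ {f} j → f ≋ [] → coeffφ f j ≋ []
  coeffφ-zero {[]} j e = ≈ₚ-refl
  coeffφ-zero {a ∷ p} zero e =
    AR.trans (+ₚ-cong (AR.trans (∷-cong (zero-head e) ≈ₚ-refl) 0∷-[]) (vanishing-times Tₚ (coeffφ-zero zero (zero-tail e))))
             (+ₚ-identityˡ [])
  coeffφ-zero {a ∷ p} (suc j) e = both-vanish _ (coeffφ-zero (suc j) (zero-tail e)) (coeffφ-zero j (zero-tail e))

  coeffφ-vanish : ∀ f j → length f ≤ j → coeffφ f j ≋ []
  coeffφ-vanish [] j le = ≈ₚ-refl
  coeffφ-vanish (a ∷ p) (suc j) (s≤s le) =
    both-vanish _ (coeffφ-vanish p (suc j) (Data.Nat.Properties.m≤n⇒m≤1+n le)) (coeffφ-vanish p j le)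

  coeffφ-0 : ∀ f → coeffφ f zero ≋ f
  coeffφ-0 [] = ≈ₚ-refl
  coeffφ-0 (a ∷ p) = AR.trans (+ₚ-congˡ (a ∷ []) (AR.trans (AR.*-comm (coeffφ p zero) Tₚ) (AR.trans (*ₚ-congˡ Tₚ (coeffφ-0 p)) (T*-shift p)))) (AR.sym (cons-split a p))

  frobⁿ-suc : ∀ j b → frobⁿ j (frob b) ≡ frobⁿ (suc j) b
  frobⁿ-suc zero b = P.refl
  frobⁿ-suc (suc j) b = P.cong frob (frobⁿ-suc j b)

  frobⁿ-φT : ∀ j b → frobⁿ j (φT b) ≋ ((Tq^ j *ₚ frobⁿ j b) +ₚ frobⁿ (suc j) b)
  frobⁿ-φT j b = AR.trans (frobⁿ-+ j (Tₚ *ₚ b) (frob b)) (+ₚ-cong (frobⁿ-* j Tₚ b) (P.subst (λ t → frobⁿ j (frob b) ≋ t) (frobⁿ-suc j b) ≈ₚ-refl))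

  φ-expansion : ∀ f b → φ f b ≋ sumTo (length f) (λ j → coeffφ f j *ₚ frobⁿ j b)
  φ-expansion [] b = ≈ₚ-refl
  φ-expansion (a ∷ p) b = AR.trans by-induction (AR.sym by-recursion)
    where
    n = length p
    H : ℕ → A
    H j = (coeffφ p j *ₚ Tq^ j) *ₚ frobⁿ j b
    J : ℕ → A
    J j = coeffφ p j *ₚ frobⁿ (suc j) b
    by-induction : φ (a ∷ p) b ≋ ((a ·ₚ b) +ₚ (sumTo n H +ₚ sumTo n J))
    by-induction = +ₚ-congˡ (a ·ₚ b) (AR.trans (φ-expansion p (φT b)) (AR.trans (sumTo-cong n (λ j → AR.trans (*ₚ-congˡ (coeffφ p j) (frobⁿ-φT j b))
              (AR.trans (AR.distribˡ (coeffφ p j) _ _) (+ₚ-congʳ (J j) (AR.sym (AR.*-assoc (coeffφ p j) (Tq^ j) (frobⁿ j b)))))))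
            (sumTo-+ n H J)))
    Hn0 : H n ≋ []
    Hn0 = vanishing-times (frobⁿ n b) (vanishing-times (Tq^ n) (coeffφ-vanish p n Data.Nat.Properties.≤-refl))
    by-recursion : sumTo (suc n) (λ j → coeffφ (a ∷ p) j *ₚ frobⁿ j b) ≋ ((a ·ₚ b) +ₚ (sumTo n H +ₚ sumTo n J))
    by-recursion = begin
      ((((a ∷ []) +ₚ (coeffφ p zero *ₚ Tₚ)) *ₚ b) +ₚ sumTo n (λ j → ((coeffφ p (suc j) *ₚ Tq^ (suc j)) +ₚ coeffφ p j) *ₚ frobⁿ (suc j) b))
        ≈⟨ +ₚ-cong (AR.distribʳ b (a ∷ []) (coeffφ p zero *ₚ Tₚ)) (AR.trans (sumTo-cong n (λ j → AR.distribʳ (frobⁿ (suc j) b) (coeffφ p (suc j) *ₚ Tq^ (suc j)) (coeffφ p j))) (sumTo-+ n (λ j → H (suc j)) J)) ⟩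
      ((((a ∷ []) *ₚ b) +ₚ H zero) +ₚ (sumTo n (λ j → H (suc j)) +ₚ sumTo n J))
        ≈⟨ CMS.solve 4 (λ x y z w → ((x ⊕ y) ⊕ (z ⊕ w)) ⊜ (x ⊕ ((y ⊕ z) ⊕ w))) ≈ₚ-refl ((a ∷ []) *ₚ b) (H zero) (sumTo n (λ j → H (suc j))) (sumTo n J) ⟩
      (((a ∷ []) *ₚ b) +ₚ ((H zero +ₚ sumTo n (λ j → H (suc j))) +ₚ sumTo n J))
        ≈⟨ +ₚ-cong (AR.trans (+ₚ-congˡ (a ·ₚ b) 0∷-[]) (+ₚ-identityʳ _)) (+ₚ-congʳ (sumTo n J) (AR.sym (sumTo-shift n H))) ⟩
      ((a ·ₚ b) +ₚ ((sumTo n H +ₚ H n) +ₚ sumTo n J))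
        ≈⟨ +ₚ-congˡ (a ·ₚ b) (+ₚ-congʳ (sumTo n J) (AR.trans (+ₚ-congˡ (sumTo n H) Hn0) (+ₚ-identityʳ _))) ⟩
      ((a ·ₚ b) +ₚ (sumTo n H +ₚ sumTo n J)) ∎
      where open import Algebra.Solver.CommutativeMonoid +ₚ-cm as CMS using (_⊕_; _⊜_)

  frob-linear-form : ∀ x τ y → frob ((x *ₚ τ) +ₚ y) ≋ ((frob x *ₚ frob τ) +ₚ frob y)
  frob-linear-form x τ y = AR.trans (frob-+ (x *ₚ τ) y) (+ₚ-congʳ (frob y) (frob-* x τ))

  commutation-step₀ : ∀ T x τ y a f → ((T *ₚ ((x *ₚ τ) +ₚ y)) +ₚ (a +ₚ (f *ₚ τ))) ≋ ((((T *ₚ x) +ₚ f) *ₚ τ) +ₚ (a +ₚ (y *ₚ T)))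
  commutation-step₀ = G.solve 6 (λ T x τ y a f → ((T :* ((x :* τ) :+ y)) :+ (a :+ (f :* τ))) := ((((T :* x) :+ f) :* τ) :+ (a :+ (y :* T)))) ≈ₚ-refl

  commutation-step : ∀ T x τ y f1 f0 → ((T *ₚ ((x *ₚ τ) +ₚ y)) +ₚ ((f1 *ₚ τ) +ₚ f0)) ≋ ((((T *ₚ x) +ₚ f1) *ₚ τ) +ₚ ((T *ₚ y) +ₚ f0))
  commutation-step = G.solve 6 (λ T x τ y f1 f0 → ((T :* ((x :* τ) :+ y)) :+ ((f1 :* τ) :+ f0)) := ((((T :* x) :+ f1) :* τ) :+ ((T :* y) :+ f0))) ≈ₚ-refl

  -- φ_T ∘ φ_f = φ_f ∘ φ_T, coefficientwise
  coeffφ-commutation : ∀ f j → ((Tₚ *ₚ coeffφ f (suc j)) +ₚ frob (coeffφ f j)) ≋ ((coeffφ f (suc j) *ₚ Tq^ (suc j)) +ₚ coeffφ f j)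
  coeffφ-commutation [] j = AR.trans (+ₚ-cong (AR.zeroʳ Tₚ) frob-0) (AR.sym (AR.trans (+ₚ-identityʳ _) (AR.zeroˡ (Tq^ (suc j)))))
  coeffφ-commutation (a ∷ p) zero = begin
    ((Tₚ *ₚ ((c1 *ₚ τ1) +ₚ c0)) +ₚ frob ((a ∷ []) +ₚ (c0 *ₚ Tₚ)))
      ≈⟨ +ₚ-congˡ (Tₚ *ₚ ((c1 *ₚ τ1) +ₚ c0)) (AR.trans (frob-+ (a ∷ []) (c0 *ₚ Tₚ)) (+ₚ-cong (frob-const a) (frob-* c0 Tₚ))) ⟩
    ((Tₚ *ₚ ((c1 *ₚ τ1) +ₚ c0)) +ₚ ((a ∷ []) +ₚ (frob c0 *ₚ τ1)))
      ≈⟨ commutation-step₀ Tₚ c1 τ1 c0 (a ∷ []) (frob c0) ⟩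
    ((((Tₚ *ₚ c1) +ₚ frob c0) *ₚ τ1) +ₚ ((a ∷ []) +ₚ (c0 *ₚ Tₚ)))
      ≈⟨ +ₚ-congʳ ((a ∷ []) +ₚ (c0 *ₚ Tₚ)) (*ₚ-congʳ τ1 (coeffφ-commutation p zero)) ⟩
    ((((c1 *ₚ τ1) +ₚ c0) *ₚ τ1) +ₚ ((a ∷ []) +ₚ (c0 *ₚ Tₚ))) ∎
    where
    c0 = coeffφ p zero
    c1 = coeffφ p (suc zero)
    τ1 = Tq^ (suc zero)
  coeffφ-commutation (a ∷ p) (suc j) = begin
    ((Tₚ *ₚ ((c2 *ₚ τ2) +ₚ c1)) +ₚ frob ((c1 *ₚ τ1) +ₚ c0))
      ≈⟨ +ₚ-congˡ (Tₚ *ₚ ((c2 *ₚ τ2) +ₚ c1)) (frob-linear-form c1 τ1 c0) ⟩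
    ((Tₚ *ₚ ((c2 *ₚ τ2) +ₚ c1)) +ₚ ((frob c1 *ₚ τ2) +ₚ frob c0))
      ≈⟨ commutation-step Tₚ c2 τ2 c1 (frob c1) (frob c0) ⟩
    ((((Tₚ *ₚ c2) +ₚ frob c1) *ₚ τ2) +ₚ ((Tₚ *ₚ c1) +ₚ frob c0))
      ≈⟨ +ₚ-cong (*ₚ-congʳ τ2 (coeffφ-commutation p (suc j))) (coeffφ-commutation p j) ⟩
    ((((c2 *ₚ τ2) +ₚ c1) *ₚ τ2) +ₚ ((c1 *ₚ τ1) +ₚ c0)) ∎
    where
    c0 = coeffφ p j
    c1 = coeffφ p (suc j)
    c2 = coeffφ p (suc (suc j))
    τ1 = Tq^ (suc j)
    τ2 = Tq^ (suc (suc j))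

  coeffφ-high : ∀ m f → (∀ i → m < i → coeff f i ≈ 0#) → ∀ j → m < j → coeffφ f j ≋ []
  coeffφ-high m [] h j _ = ≈ₚ-refl
  coeffφ-high zero (a ∷ p) h (suc j) _ = both-vanish _ (coeffφ-zero {p} (suc j) p≋0) (coeffφ-zero {p} j p≋0)
    where
    p≋0 : p ≋ []
    p≋0 = mk λ i → h (suc i) (s≤s z≤n)
  coeffφ-high (suc m) (a ∷ p) h (suc j) (s≤s m<j) =
    both-vanish _ (coeffφ-high m p h' (suc j) (Data.Nat.Properties.m<n⇒m<1+n m<j)) (coeffφ-high m p h' j m<j)
    where
    h' : ∀ i → m < i → coeff p i ≈ 0#
    h' i m<i = h (suc i) (s≤s m<i)

  coeffφ-top : ∀ m f → (∀ i → m < i → coeff f i ≈ 0#) → coeffφ f m ≋ (coeff f m ∷ [])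
  coeffφ-top m [] h = AR.sym 0∷-[]
  coeffφ-top zero (a ∷ p) h =
    AR.trans (+ₚ-congˡ (a ∷ []) (vanishing-times Tₚ (coeffφ-zero {p} zero (mk λ i → h (suc i) (s≤s z≤n)))))
             (+ₚ-identityʳ (a ∷ []))
  coeffφ-top (suc m) (a ∷ p) h =
    AR.trans (+ₚ-congʳ (coeffφ p m) (vanishing-times _ (coeffφ-high m p h' (suc m) (Data.Nat.Properties.n<1+n m))))
             (AR.trans (+ₚ-identityˡ (coeffφ p m)) (coeffφ-top m p h'))
    where
    h' : ∀ i → m < i → coeff p i ≈ 0#
    h' i m<i = h (suc i) (s≤s m<i)

-- The
-- multiples of X are stable under frob and hence under every φ_f; if
-- X ∣ y then X² ∣ y^q (as q ≥ 2), so modulo X² the action on multiples of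
-- X is linear: φ_f(y) ≡ f·y, and in particular X² ∣ φ_X(y).
module CarlitzDivisibility {c ℓ : Level} (F : FiniteField c ℓ) (q≥2 : 2 ≤ FiniteField.size F) where
  open import Data.Nat using (ℕ; zero; suc; _≤_; s≤s; z≤n)
  open import Data.Nat.Properties using (≤-trans)
  open import Data.List using ([]; _∷_)
  open import Data.Product using (Σ; _,_)
  open import Relation.Binary.PropositionalEquality as P using (_≡_)
  import Relation.Binary.Reasoning.Setoid as SR
  open FiniteField F renaming (Carrier to K) hiding (zero)
  open Poly F
  open PolyRing F
  open Frobenius F (≤-trans (s≤s z≤n) q≥2)
  open CarlitzLinearity F (≤-trans (s≤s z≤n) q≥2)
  open SR AR.setoid

  module _ (X : A) where
    open Multiples X

    dv-frob : ∀ {y} → X ∣′ y → X ∣′ frob y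
    dv-frob {y} h = P.subst (λ n → X ∣′ (y ^ₚ n)) e₀ (dv-*r (y ^ₚ m₀) h)

    dv-φT : ∀ {y} → X ∣′ y → X ∣′ φT y
    dv-φT h = dv-+ (dv-* Tₚ h) (dv-frob h)

    dv-φ : ∀ f {y} → X ∣′ y → X ∣′ φ f y
    dv-φ [] h = dv0
    dv-φ (a ∷ p) {y} h = dv-+ (dv-cong (AR.sym (·-as-* a y)) (dv-* (a ∷ []) h)) (dv-φ p (dv-φT h))

  q-split : Σ ℕ (λ m → size ≡ suc (suc m))
  q-split = split size q≥2
    where
    split : ∀ n → 2 ≤ n → Σ ℕ (λ m → n ≡ suc (suc m))
    split (suc (suc m)) _ = m , P.refl
    split (suc zero) (s≤s ())

  module _ (X : A) where
    open Multiples (X ^ₚ 2)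

    frob-square : ∀ {y} → X ∣′ y → (X ^ₚ 2) ∣′ frob y
    frob-square {y} (z , ez) with q-split
    ... | m , eq = P.subst (λ n → (X ^ₚ 2) ∣′ (y ^ₚ n)) (P.sym eq) ((z *ₚ (z *ₚ (y ^ₚ m))) , chain)
      where
      chain : ((z *ₚ (z *ₚ (y ^ₚ m))) *ₚ (X ^ₚ 2)) ≋ (y *ₚ (y *ₚ (y ^ₚ m)))
      chain = begin
        ((z *ₚ (z *ₚ (y ^ₚ m))) *ₚ (X *ₚ (X *ₚ 1ₚ)))
          ≈⟨ G.solve 4 (λ z Y x one → ((z G.:* (z G.:* Y)) G.:* (x G.:* (x G.:* one)))
                                       G.:= ((z G.:* x) G.:* ((z G.:* x) G.:* (Y G.:* one)))) ≈ₚ-refl z (y ^ₚ m) X 1ₚ ⟩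
        ((z *ₚ X) *ₚ ((z *ₚ X) *ₚ ((y ^ₚ m) *ₚ 1ₚ))) ≈⟨ AR.*-cong ez (AR.*-cong ez (AR.*-identityʳ _)) ⟩
        (y *ₚ (y *ₚ (y ^ₚ m))) ∎

    φ-linear-mod-square : ∀ f {y} → X ∣′ y → (X ^ₚ 2) ∣′ (φ f y -ₚ (f *ₚ y))
    φ-linear-mod-square [] {y} h = dv-cong (AR.sym (AR.-‿inverseʳ [])) dv0
    φ-linear-mod-square (a ∷ p) {y} h =
      dv-cong (AR.sym split) (dv-+ (φ-linear-mod-square p (dv-φT X h)) (dv-* p (frob-square h)))
      where
      w = φT y
      Tp-comm : (0# ∷ (p *ₚ y)) ≋ (p *ₚ (Tₚ *ₚ y))
      Tp-comm = begin
        (0# ∷ (p *ₚ y)) ≈⟨ AR.sym (T*-shift (p *ₚ y)) ⟩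
        (Tₚ *ₚ (p *ₚ y)) ≈⟨ AR.sym (AR.*-assoc Tₚ p y) ⟩
        ((Tₚ *ₚ p) *ₚ y) ≈⟨ *ₚ-congʳ y (AR.*-comm Tₚ p) ⟩
        ((p *ₚ Tₚ) *ₚ y) ≈⟨ AR.*-assoc p Tₚ y ⟩
        (p *ₚ (Tₚ *ₚ y)) ∎
      split : (φ (a ∷ p) y -ₚ ((a ∷ p) *ₚ y)) ≋ ((φ p w -ₚ (p *ₚ w)) +ₚ (p *ₚ frob y))
      split = begin
        ((a ·ₚ y) +ₚ φ p w) -ₚ ((a ·ₚ y) +ₚ (0# ∷ (p *ₚ y))) ≈⟨ G.sub-cancelˡ (a ·ₚ y) (φ p w) (0# ∷ (p *ₚ y)) ⟩
        φ p w -ₚ (0# ∷ (p *ₚ y)) ≈⟨ +ₚ-congˡ (φ p w) (-ₚ-cong Tp-comm) ⟩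
        φ p w -ₚ (p *ₚ (Tₚ *ₚ y)) ≈⟨ G.sub-split (φ p w) (p *ₚ (Tₚ *ₚ y)) (p *ₚ frob y) ⟩
        (φ p w -ₚ ((p *ₚ (Tₚ *ₚ y)) +ₚ (p *ₚ frob y))) +ₚ (p *ₚ frob y)
          ≈⟨ +ₚ-congʳ (p *ₚ frob y) (+ₚ-congˡ (φ p w) (-ₚ-cong (AR.sym (AR.distribˡ p (Tₚ *ₚ y) (frob y))))) ⟩
        (φ p w -ₚ (p *ₚ w)) +ₚ (p *ₚ frob y) ∎

    φ-self-mod-square : ∀ {y} → X ∣′ y → (X ^ₚ 2) ∣′ φ X y
    φ-self-mod-square {y} (z , ez) =
      dv-cong (AR.sym (G.sub-add-cancel (φ X y) (X *ₚ y))) (dv-+ (φ-linear-mod-square X (z , ez)) (z , chain))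
      where
      chain : (z *ₚ (X ^ₚ 2)) ≋ (X *ₚ y)
      chain = begin
        (z *ₚ (X *ₚ (X *ₚ 1ₚ)))
          ≈⟨ G.solve 3 (λ z x one → (z G.:* (x G.:* (x G.:* one))) G.:= (x G.:* ((z G.:* x) G.:* one))) ≈ₚ-refl z X 1ₚ ⟩
        (X *ₚ ((z *ₚ X) *ₚ 1ₚ)) ≈⟨ *ₚ-congˡ X (AR.trans (AR.*-identityʳ _) ez) ⟩
        (X *ₚ y) ∎

-- Frobenius has no short orbit on T modulo P: if 0 < i < d = deg P then
-- P ∤ T^(q^i) − T.  Otherwise frobⁱ ≡ id on A/P (it is a ring endomorphism
-- fixing T and the constants), so the q^(i+1) polynomials with i + 1 ≤ d
-- coefficients, which are pairwise incongruent modulo P, are all roots of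
-- the monic polynomial X^(q^i) − X over the domain A/P: too many roots.
module FrobeniusOrbit {c ℓ : Level} (F : FiniteField c ℓ) (q≥2 : 2 ≤ FiniteField.size F)
          (PP : Poly.A F) (monic : Poly.Monic F PP) (irr : Poly.Irreducible F PP) where
  open import Data.Nat using (ℕ; zero; suc; _≤_; _<_; z≤n; s≤s; _^_)
  open import Data.Nat.Properties using (≤-trans; n<1+n; ^-monoʳ-<)
  open import Data.Fin using (Fin; inject≤; remQuot; combine) renaming (zero to fz)
  open import Data.Fin.Properties using (inject≤-injective; combine-remQuot)
  open import Data.List using (List; []; _∷_; length)
  open import Data.Product using (Σ; _,_; proj₁; proj₂; uncurry)
  open import Relation.Nullary using (¬_)
  open import Relation.Binary.PropositionalEquality as P using (_≡_)
  open FiniteField F renaming (Carrier to K) hiding (zero)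
  open Poly F
  open PolyRing F
  open Frobenius F (≤-trans (s≤s z≤n) q≥2)
  open CarlitzExpansion F (≤-trans (s≤s z≤n) q≥2) using (Tq^)
  open IrreducibleDivisor F PP monic irr
  open CongruenceModP F PP monic irr
  open RootBound Kring using (eval; lastCoeff; too-many-roots)

  -- the polynomials with k coefficients, indexed by Fin (q^k) through base-q digits
  digits : ∀ k → Fin (size ^ k) → A
  digits zero _ = []
  digits (suc k) x = enum (proj₁ (remQuot {size} (size ^ k) x)) ∷ digits k (proj₂ (remQuot {size} (size ^ k) x))

  length-digits : ∀ k x → length (digits k x) ≡ k
  length-digits zero x = P.refl
  length-digits (suc k) x = P.cong suc (length-digits k _)

  digits-inj : ∀ k x y → digits k x ≋ digits k y → x ≡ y
  digits-inj zero fz fz e = P.refl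
  digits-inj (suc k) x y e = P.trans (P.sym (combine-remQuot {size} (size ^ k) x))
    (P.trans (P.cong (uncurry combine) (P.cong₂ _,_ (enum-inj _ _ (get e zero)) (digits-inj k _ _ (mk λ n → get e (suc n)))))
      (combine-remQuot {size} (size ^ k) y))

  -- for k ≤ d they stay distinct modulo P, as their differences are too short to be multiples of P
  digits-distinct : ∀ k → k ≤ d → ∀ x y → digits k x ~ digits k y → x ≡ y
  digits-distinct k k≤d x y h = digits-inj k x y (G.x∙y⁻¹≈ε⇒x≈y _ _ difference-zero)
    where
    short : ∀ z n → d ≤ n → coeff (digits k z) n ≈ 0#
    short z n d≤n = coeff-beyond (digits k z) n (P.subst (_≤ n) (P.sym (length-digits k z)) (≤-trans k≤d d≤n))
    above-d : ∀ n → d ≤ n → coeff (digits k x -ₚ digits k y) n ≈ 0#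
    above-d n d≤n = trans (coeff-+ (digits k x) _ n)
      (trans (+-cong (short x n d≤n) (trans (coeff-neg (digits k y) n) (trans (-‿cong (short y n d≤n)) -0#≈0#)))
             (+-identityʳ 0#))
    difference-zero : (digits k x -ₚ digits k y) ≋ []
    difference-zero = multiple-below-degree _ above-d (dv h)

  -- X^k and X^(k+2) − X as polynomials with coefficients in A/P
  monomial : ℕ → List A
  monomial zero = 1ₚ ∷ []
  monomial (suc k) = [] ∷ monomial k

  length-monomial : ∀ k → length (monomial k) ≡ suc k
  length-monomial zero = P.refl
  length-monomial (suc k) = P.cong suc (length-monomial k)

  lastCoeff-monomial : ∀ k → lastCoeff (monomial k) ≡ 1ₚ
  lastCoeff-monomial zero = P.refl
  lastCoeff-monomial (suc zero) = P.refl
  lastCoeff-monomial (suc (suc k)) = lastCoeff-monomial (suc k)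

  eval-monomial : ∀ k x → eval (monomial k) x ≋ (x ^ₚ k)
  eval-monomial zero x = AR.trans (+ₚ-congˡ 1ₚ (AR.zeroʳ x)) (+ₚ-identityʳ 1ₚ)
  eval-monomial (suc k) x = AR.trans (+ₚ-identityˡ _) (*ₚ-congˡ x (eval-monomial k x))

  fixedPointPoly : ℕ → List A
  fixedPointPoly k = [] ∷ (-ₚ 1ₚ) ∷ monomial k

  eval-fixedPointPoly : ∀ k x → eval (fixedPointPoly k) x ≋ ((x ^ₚ suc (suc k)) -ₚ x)
  eval-fixedPointPoly k x = AR.trans (+ₚ-identityˡ _)
    (AR.trans (*ₚ-congˡ x (+ₚ-congˡ (-ₚ 1ₚ) (*ₚ-congˡ x (eval-monomial k x)))) (G.times-pred x (x *ₚ (x ^ₚ k))))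

  lastCoeff-fixedPointPoly : ∀ k → lastCoeff (fixedPointPoly k) ≡ 1ₚ
  lastCoeff-fixedPointPoly zero = P.refl
  lastCoeff-fixedPointPoly (suc k) = lastCoeff-monomial (suc k)

  -- a ring endomorphism fixing T modulo P fixes every polynomial modulo P
  frobⁿ-fixes-all : ∀ i → frobⁿ i Tₚ ~ Tₚ → ∀ f → frobⁿ i f ~ f
  frobⁿ-fixes-all i fixT [] = ≋⇒~ (frobⁿ-0 i)
  frobⁿ-fixes-all i fixT (a ∷ p) =
    ~-trans (≋⇒~ (AR.trans (frobⁿ-cong i (cons-as-T a p))
                   (AR.trans (frobⁿ-+ i (a ∷ []) (Tₚ *ₚ p)) (+ₚ-cong (frobⁿ-const i a) (frobⁿ-* i Tₚ p)))))
      (~-trans (~-+ (~-refl {a ∷ []}) (~-* fixT (frobⁿ-fixes-all i fixT p))) (≋⇒~ (AR.sym (cons-as-T a p))))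

  q^-split : ∀ i → 0 < i → Σ ℕ (λ k → size ^ i ≡ suc (suc k))
  q^-split i 0<i = split (size ^ i) (^-monoʳ-< size q≥2 0<i)
    where
    split : ∀ n → 2 ≤ n → Σ ℕ (λ k → n ≡ suc (suc k))
    split (suc (suc k)) _ = k , P.refl
    split (suc zero) (s≤s ())

  T-not-fixed : ∀ i → 0 < i → i < d → ¬ (PP ∣′ (Tq^ i -ₚ Tₚ))
  T-not-fixed i 0<i i<d P∣ =
    too-many-roots K-1≉0 K-dom (suc (suc k)) (fixedPointPoly k)
      (P.cong (λ t → suc (suc t)) (length-monomial k))
      (≋⇒~ (P.subst (λ t → t ≋ 1ₚ) (P.sym (lastCoeff-fixedPointPoly k)) ≈ₚ-refl))
      roots roots-distinct are-roots
    where
    k = proj₁ (q^-split i 0<i)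
    q^i≡ = proj₂ (q^-split i 0<i)
    enough : suc (suc (suc k)) ≤ size ^ suc i
    enough = P.subst (λ t → suc t ≤ size ^ suc i) q^i≡ (^-monoʳ-< size q≥2 (n<1+n i))
    roots : Fin (suc (suc (suc k))) → A
    roots j = digits (suc i) (inject≤ j enough)
    roots-distinct : ∀ j j' → roots j ~ roots j' → j ≡ j'
    roots-distinct j j' e = inject≤-injective enough enough j j' (digits-distinct (suc i) i<d _ _ e)
    are-roots : ∀ j → eval (fixedPointPoly k) (roots j) ~ []
    are-roots j = ~-trans (≋⇒~ (eval-fixedPointPoly k x))
      (~-trans (~-+ (~-trans (≋⇒~ (AR.sym (P.subst (λ t → frobⁿ i x ≋ (x ^ₚ t)) q^i≡ (frobⁿ-pow i x))))
                             (frobⁿ-fixes-all i (mk~ P∣) x))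
                    (~-refl { -ₚ x}))
               (≋⇒~ (AR.-‿inverseʳ x)))
      where
      x = roots j

-- By the
-- Carlitz expansion φ_P(1) = Σ_j c_j(P); here c_0(P) = P, c_d(P) = 1, the
-- c_j(P) vanish for j > d, and for 0 < j < d the commutation relation gives
-- (T^(q^j) − T)·c_j(P) = c_{j−1}(P)^q − c_{j−1}(P), so P ∣ c_j(P) by
-- induction, P being prime and not dividing T^(q^j) − T.  Hence
-- φ_P(1) ≡ 1 (mod P), and φ_{P−1}(1) = φ_P(1) − 1.
module CarlitzFermat {c ℓ : Level} (F : FiniteField c ℓ) (q≥2 : 2 ≤ FiniteField.size F)
          (PP : Poly.A F) (monic : Poly.Monic F PP) (irr : Poly.Irreducible F PP) where
  open import Data.Nat using (zero; suc; _≤_; _<_; z≤n; s≤s)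
  import Data.Nat.Properties as NP
  open import Data.List using (length)
  open import Data.Product using (_,_)
  open import Relation.Nullary using (¬_)
  open import Relation.Binary.Definitions using (tri<; tri≈; tri>)
  open import Data.Empty using (⊥-elim)
  open import Data.Sum using (inj₁; inj₂)
  open import Relation.Binary.PropositionalEquality as P using (_≡_)
  open FiniteField F renaming (Carrier to K) hiding (zero)
  open Poly F
  open PolyRing F
  open Frobenius F (NP.≤-trans (s≤s z≤n) q≥2)
  open CarlitzLinearity F (NP.≤-trans (s≤s z≤n) q≥2)
  open CarlitzExpansion F (NP.≤-trans (s≤s z≤n) q≥2)
  open CarlitzDivisibility F q≥2 using (dv-frob)
  open IrreducibleDivisor F PP monic irr
  open CongruenceModP F PP monic irr
  open FrobeniusOrbit F q≥2 PP monic irr using (T-not-fixed)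

  P∣coeffφP : ∀ j → j < d → PP ∣′ coeffφ PP j
  P∣coeffφP zero _ = 1ₚ , AR.trans (AR.*-identityˡ PP) (AR.sym (coeffφ-0 PP))
  P∣coeffφP (suc j) sj<d = prime (T-not-fixed (suc j) (s≤s z≤n) sj<d) (dv-cong (AR.sym commutation) P∣prev^q-prev)
    where
    next = coeffφ PP (suc j)
    prev = coeffφ PP j
    commutation : ((Tq^ (suc j) -ₚ Tₚ) *ₚ next) ≋ (frob prev -ₚ prev)
    commutation = G.commutation-as-product Tₚ next (Tq^ (suc j)) prev (frob prev) (coeffφ-commutation PP j)
    P∣prev : PP ∣′ prev
    P∣prev = P∣coeffφP j (NP.<-trans (NP.n<1+n j) sj<d)
    P∣prev^q-prev : PP ∣′ (frob prev -ₚ prev)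
    P∣prev^q-prev = dv-+ (dv-frob PP P∣prev) (dv-neg P∣prev)

  d<length : d < length PP
  d<length with NP.≤-<-connex (length PP) d
  ... | inj₂ lt = lt
  ... | inj₁ L≤d = ⊥-elim (0≉1 (trans (sym (coeff-beyond PP d L≤d)) lead))

  dv-sum : ∀ N g → (∀ j → j < N → PP ∣′ g j) → PP ∣′ sumTo N g
  dv-sum zero g h = dv0
  dv-sum (suc N) g h = dv-+ (h zero (s≤s z≤n)) (dv-sum N (λ j → g (suc j)) (λ j lt → h (suc j) (s≤s lt)))

  dv-sum-except : ∀ N g e → e < N → (∀ j → ¬ (j ≡ e) → j < N → PP ∣′ g j) → PP ∣′ (sumTo N g -ₚ g e)
  dv-sum-except (suc N) g zero _ h =
    dv-cong (AR.sym (G.xyx⁻¹≈y (g zero) (sumTo N (λ j → g (suc j)))))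
      (dv-sum N (λ j → g (suc j)) (λ j lt → h (suc j) (λ ()) (s≤s lt)))
  dv-sum-except (suc N) g (suc e) (s≤s e<N) h =
    dv-cong (AR.sym (AR.+-assoc (g zero) (sumTo N (λ j → g (suc j))) (-ₚ g (suc e))))
      (dv-+ (h zero (λ ()) (s≤s z≤n))
            (dv-sum-except N (λ j → g (suc j)) e e<N (λ j ne lt → h (suc j) (λ eq → ne (NP.suc-injective eq)) (s≤s lt))))

  φP1≡1 : PP ∣′ (φ PP 1ₚ -ₚ 1ₚ)
  φP1≡1 = dv-cong expansion (dv-sum-except (length PP) (coeffφ PP) d d<length others)
    where
    others : ∀ j → ¬ (j ≡ d) → j < length PP → PP ∣′ coeffφ PP j
    others j ne _ with NP.<-cmp j d
    ... | tri< lt _ _ = P∣coeffφP j lt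
    ... | tri≈ _ e _ = ⊥-elim (ne e)
    ... | tri> _ _ gt = dv-cong (AR.sym (coeffφ-high d PP high j gt)) dv0
    top : coeffφ PP d ≋ 1ₚ
    top = AR.trans (coeffφ-top d PP high) (∷-cong lead ≈ₚ-refl)
    φP1 : φ PP 1ₚ ≋ sumTo (length PP) (coeffφ PP)
    φP1 = AR.trans (φ-expansion PP 1ₚ)
      (sumTo-cong (length PP) (λ j → AR.trans (*ₚ-congˡ (coeffφ PP j) (frobⁿ-const j 1#)) (AR.*-identityʳ (coeffφ PP j))))
    expansion : (sumTo (length PP) (coeffφ PP) -ₚ coeffφ PP d) ≋ (φ PP 1ₚ -ₚ 1ₚ)
    expansion = +ₚ-cong (AR.sym φP1) (-ₚ-cong top)

  φ-minus-one : φ (-ₚ 1ₚ) 1ₚ ≋ (-ₚ 1ₚ)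
  φ-minus-one = AR.trans (+ₚ-identityʳ ((- 1#) ·ₚ 1ₚ)) (mk λ { zero → *-identityʳ _ ; (suc n) → refl })

  carlitz-fermat : PP ∣′ φ (PP -ₚ 1ₚ) 1ₚ
  carlitz-fermat = dv-cong (AR.sym (AR.trans (φ-+ˡ PP (-ₚ 1ₚ) 1ₚ) (+ₚ-congˡ (φ PP 1ₚ) φ-minus-one))) φP1≡1

module MainTheorem {c ℓ : Level} (F : FiniteField c ℓ) (q≥2 : 2 ≤ FiniteField.size F)
          (PP : Poly.A F) (monic : Poly.Monic F PP) (irr : Poly.Irreducible F PP) where
  open import Data.Nat using (s≤s; z≤n)
  open import Data.Nat.Properties using (≤-trans)
  open import Data.Product using (∃; _×_; _,_)
  open import Relation.Nullary using (¬_)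
  import Relation.Binary.Reasoning.Setoid as SR
  open FiniteField F renaming (Carrier to K) hiding (zero)
  open Poly F
  open PolyRing F
  open CarlitzLinearity F (≤-trans (s≤s z≤n) q≥2)
  open CarlitzDivisibility F q≥2
  open IrreducibleDivisor F PP monic irr using (P∤1; bezout)
  open CarlitzFermat F q≥2 PP monic irr using (carlitz-fermat)
  open Multiples (PP ^ₚ 2)
  open SR AR.setoid

  P∤P-1 : ¬ (PP ∣′ (PP -ₚ 1ₚ))
  P∤P-1 (z , e) = P∤1 ((1ₚ -ₚ z) , G.unit-from-multiple z PP e)

  square-criterion : ∀ a → ¬ (PP ∣′ a) → (PP ^ₚ 2) ∣′ φ a 1ₚ → (PP ^ₚ 2) ∣′ φ (PP -ₚ 1ₚ) 1ₚ
  square-criterion a P∤a P²∣φa1 with bezout a P∤a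
  ... | u , w , ua+wP≈1 =
    dv-cong (AR.sym decomposition) (dv-+ (dv-φ (PP ^ₚ 2) (e *ₚ u) P²∣φa1) (dv-φ (PP ^ₚ 2) w P²∣φPe1))
    where
    e = PP -ₚ 1ₚ
    P²∣φPe1 : (PP ^ₚ 2) ∣′ φ (PP *ₚ e) 1ₚ
    P²∣φPe1 = dv-cong (AR.sym (φ-* PP e 1ₚ)) (φ-self-mod-square PP carlitz-fermat)
    decomposition : φ e 1ₚ ≋ (φ (e *ₚ u) (φ a 1ₚ) +ₚ φ w (φ (PP *ₚ e) 1ₚ))
    decomposition = begin
      φ e 1ₚ ≈⟨ φ-congˡ 1ₚ (G.bezout-scaled e u a w PP ua+wP≈1) ⟩
      φ (((e *ₚ u) *ₚ a) +ₚ (w *ₚ (PP *ₚ e))) 1ₚ ≈⟨ φ-+ˡ ((e *ₚ u) *ₚ a) (w *ₚ (PP *ₚ e)) 1ₚ ⟩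
      (φ ((e *ₚ u) *ₚ a) 1ₚ +ₚ φ (w *ₚ (PP *ₚ e)) 1ₚ) ≈⟨ +ₚ-cong (φ-* (e *ₚ u) a 1ₚ) (φ-* w (PP *ₚ e) 1ₚ) ⟩
      (φ (e *ₚ u) (φ a 1ₚ) +ₚ φ w (φ (PP *ₚ e) 1ₚ)) ∎

corollary3 : ∀ {c ℓ : Level} (F : FiniteField c ℓ) → 3 ≤ Poly.q F →
             ∀ (P : Poly.A F) → Poly.Monic F P → Poly.Irreducible F P →
             (Poly._∣_ F (Poly._^ₚ_ F P 2) (Poly.φ F (Poly._-ₚ_ F P (Poly.1ₚ F)) (Poly.1ₚ F))
               ⇔ (∃ λ (a : Poly.A F) → (¬ Poly._∣_ F P a)
                    × Poly._∣_ F (Poly._^ₚ_ F P 2) (Poly.φ F a (Poly.1ₚ F))))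
corollary3 F q≥3 P monic irr = mk⇔ forward backward
  where
  open Poly F
  open PolyRing F using (∣⇒∣′; ∣′⇒∣)
  open MainTheorem F (≤-trans (n≤1+n 2) q≥3) P monic irr
  forward : P ^ₚ 2 ∣ φ (P -ₚ 1ₚ) 1ₚ → ∃ λ a → (¬ P ∣ a) × (P ^ₚ 2 ∣ φ a 1ₚ)
  forward P²∣ = (P -ₚ 1ₚ) , (λ P∣ → P∤P-1 (∣⇒∣′ P∣)) , P²∣
  backward : (∃ λ a → (¬ P ∣ a) × (P ^ₚ 2 ∣ φ a 1ₚ)) → P ^ₚ 2 ∣ φ (P -ₚ 1ₚ) 1ₚ
  backward (a , P∤a , P²∣) = ∣′⇒∣ (square-criterion a (λ P∣ → P∤a (∣′⇒∣ P∣)) (∣⇒∣′ P²∣))
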